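{- Let $\mathcal{X}_{1,1}$ be the family of all graphs $X_{f,q}$ and $X_{xyf,q}$, where $q$ ranges over odd prime powers and $f\in\mathbb{F}_q[x,y]$ is an admissible polynomial of bidegree $(1,1)$ (degree $1$ in $x$ and degree $1$ in $y$). Then $\mathcal{X}_{1,1}$ is a family of quasi-random graphs with property $QR(1/2)$.
   Context: An element of $\mathbb{F}_q$ is a square if it equals $z^2$ for some $z$ (so $0$ is a square). For $p\in\mathbb{F}_q[x,y]$, $X_{p,q}$ is the simple graph on $\mathbb{F}_q$ in which distinct $a,b$ are adjacent iff $p(a,b)$ is a square; $X_{xyf,q}$ means $X_{p,q}$ with $p(x,y)=xyf(x,y)$. Write $f=F(x)G(y)H(x,y)$ with $H$ primitive in both $x$ and $y$ (no nonconstant factor in $\mathbb{F}_q[x]$ or $\mathbb{F}_q[y]$), the primitive kernel. $f$ is admissible if (i) for all $u,v\in\mathbb{F}_q$, $f(u,v)$ is a square iff $f(v,u)$ is, and (ii) $H$ is not a constant multiple of the square of a polynomial. $e(S,T)$ is the number of pairs $(s,t)\in S\times T$ with $s,t$ adjacent. A family of graphs with unbounded numbers of vertices has property $QR(\theta)$ if there is $c>0$ with $|e(S,T)-|S||T|/2|\le cn^\theta\sqrt{|S||T|}$ for all its graphs ($n$ vertices) and all vertex subsets $S,T$. -}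

module Defs where

open import Level using (0ℓ)
open import Data.Nat as ℕ using (ℕ; zero; suc)
open import Data.Fin using (Fin)
open import Data.Fin.Properties using (any?)
open import Data.Fin.Subset using (Subset; ∣_∣)
open import Data.Bool using (Bool; true; false; _∧_; if_then_else_)
open import Data.Vec using (lookup)
open import Data.List using (List; []; _∷_; foldr; map; allFin)
open import Data.Nat.ListAction using (sum)
open import Data.Product using (Σ; ∃; ∃-syntax; _×_; _,_)
open import Data.Sum using (_⊎_)
open import Data.Integer as ℤ using (ℤ; +_)
open import Relation.Nullary using (¬_; Dec; yes; no; does)
open import Relation.Binary.PropositionalEquality using (_≡_; _≢_)
open import Algebra.Structures using (IsCommutativeRing)
open import Function using (_⇔_)

-- A finite field with q elements, carried by Fin q (every finite field
-- of order q is isomorphic to one of these).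

record FiniteField (q : ℕ) : Set where
  field
    _+_ _*_ : Fin q → Fin q → Fin q
    -_      : Fin q → Fin q
    0# 1#   : Fin q
    isCommutativeRing : IsCommutativeRing _≡_ _+_ _*_ -_ 0# 1#
    0≢1     : 0# ≢ 1#
    inverse : ∀ x → x ≢ 0# → ∃[ y ] (x * y ≡ 1#)
  infixl 6 _+_
  infixl 7 _*_

  _≟_ : (x y : Fin q) → Dec (x ≡ y)
  _≟_ = Data.Fin._≟_

  -- a is a square if a = z² for some z (so 0 is a square)
  IsSquare : Fin q → Set
  IsSquare a = ∃[ z ] (z * z ≡ a)

  isSquare? : (a : Fin q) → Dec (IsSquare a)
  isSquare? a = any? (λ z → (z * z) ≟ a)

  -- Bivariate polynomials over F_q, as coefficient arrays
  -- (coef i j = coefficient of x^i y^j) with finite support.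

  Coeffs : Set
  Coeffs = ℕ → ℕ → Fin q

  IsPoly : Coeffs → Set
  IsPoly p = ∃[ N ] (∀ i j → (N ℕ.< i ⊎ N ℕ.< j) → p i j ≡ 0#)

  Σ≤ : ℕ → (ℕ → Fin q) → Fin q
  Σ≤ zero    g = g 0
  Σ≤ (suc n) g = Σ≤ n g + g (suc n)

  _·_ : Coeffs → Coeffs → Coeffs
  (p · r) i j = Σ≤ i (λ k → Σ≤ j (λ l → p k l * r (i ℕ.∸ k) (j ℕ.∸ l)))

  _⋆_ : Fin q → Coeffs → Coeffs
  (c ⋆ p) i j = c * p i j

  _≐_ : Coeffs → Coeffs → Set
  p ≐ r = ∀ i j → p i j ≡ r i j

  InFx : Coeffs → Set
  InFx p = IsPoly p × (∀ i j → j ≢ 0 → p i j ≡ 0#)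

  InFy : Coeffs → Set
  InFy p = IsPoly p × (∀ i j → i ≢ 0 → p i j ≡ 0#)

  NonConstant : Coeffs → Set
  NonConstant p = ∃[ i ] ∃[ j ] ((i ≢ 0 ⊎ j ≢ 0) × p i j ≢ 0#)

  PrimitiveInX : Coeffs → Set
  PrimitiveInX h = ¬ (∃[ P ] ∃[ R ] (InFx P × NonConstant P × IsPoly R × (h ≐ (P · R))))

  PrimitiveInY : Coeffs → Set
  PrimitiveInY h = ¬ (∃[ P ] ∃[ R ] (InFy P × NonConstant P × IsPoly R × (h ≐ (P · R))))

  ConstTimesSquare : Coeffs → Set
  ConstTimesSquare h = ∃[ c ] ∃[ K ] (IsPoly K × (h ≐ (c ⋆ (K · K))))

  PrimitiveKernelOf : Coeffs → Coeffs → Set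
  PrimitiveKernelOf f h =
    ∃[ F ] ∃[ G ] (InFx F × InFy G × IsPoly h × PrimitiveInX h × PrimitiveInY h
                   × (f ≐ ((F · G) · h)))

  Bidegree11 : Coeffs → Set
  Bidegree11 f = (∀ i j → (1 ℕ.< i ⊎ 1 ℕ.< j) → f i j ≡ 0#)
               × (∃[ j ] (f 1 j ≢ 0#))
               × (∃[ i ] (f i 1 ≢ 0#))

  eval11 : Coeffs → Fin q → Fin q → Fin q
  eval11 f u v = f 0 0 + f 1 0 * u + f 0 1 * v + f 1 1 * (u * v)

  Admissible11 : Coeffs → Set
  Admissible11 f =
      (∀ u v → IsSquare (eval11 f u v) ⇔ IsSquare (eval11 f v u))
    × (∀ h → PrimitiveKernelOf f h → ¬ ConstTimesSquare h)

  adjᵇ : (Fin q → Fin q → Fin q) → Fin q → Fin q → Bool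
  adjᵇ p a b with a ≟ b
  ... | yes _ = false
  ... | no  _ = does (isSquare? (p a b))

  edges : (Fin q → Fin q → Fin q) → Subset q → Subset q → ℕ
  edges p S T =
    sum (map (λ s → sum (map (λ t →
          if lookup S s ∧ lookup T t ∧ adjᵇ p s t then 1 else 0) (allFin q)))
        (allFin q))

  graphF : Coeffs → Fin q → Fin q → Fin q
  graphF f a b = eval11 f a b

  graphXYF : Coeffs → Fin q → Fin q → Fin q
  graphXYF f a b = a * b * eval11 f a b

-- QR(1/2) bound for one graph on n = q vertices with constant C,
-- in squared form:  (2 e(S,T) - |S||T|)² ≤ C · n · |S| · |T|.
-- (Equivalent to |e - |S||T|/2| ≤ c n^{1/2} sqrt(|S||T|) with C = 4c².)

QRBound : (q : ℕ) → ℕ → ((Fin q → Fin q → Fin q) → Subset q → Subset q → ℕ)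
        → (Fin q → Fin q → Fin q) → Set
QRBound q C e p = ∀ (S T : Subset q) →
  let d = (+ (2 ℕ.* e p S T)) ℤ.- (+ (∣ S ∣ ℕ.* ∣ T ∣)) in
  d ℤ.* d ℤ.≤ + (C ℕ.* q ℕ.* ∣ S ∣ ℕ.* ∣ T ∣)

{-# OPTIONS --safe #-}
-- Write f(s, t) = α(t) + β(t) s.  Admissibility forces  f₀₀ f₁₁ − f₁₀ f₀₁ ≠ 0: otherwise
-- f = F(x) G(y) and its primitive kernel is the constant 1, a square.  Hence for t ≠ t′ the
-- linear forms s ↦ f(s, t) and s ↦ f(s, t′) are independent, and a Jacobsthal-type evaluation
-- gives  |Σ_s χ(f(s, t)) χ(f(s, t′))| ≤ 1  for the quadratic character χ.  Away from at most five
-- values of s, the product of the ±1 adjacency signs of s towards t and t′ is exactly this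
-- character product (times χ(t) χ(t′) for x y f), so every codegree  Σ_s a(s, t) a(s, t′)  is at
-- most 11.  Finally, by Cauchy–Schwarz,
--   (2 e(S, T) − |S| |T|)² ≤ |S| Σ_s (Σ_{t ∈ T} a(s, t))² = |S| Σ_{t, t′ ∈ T} codegree(t, t′)
--                          ≤ |S| (3 q |T| + 11 |T|²) ≤ 14 q |S| |T|,
-- where 3 q |T| covers the pairs with t = t′ or passing through the vertex 0.
module Submission where

open import Defs
open import Data.Nat using (ℕ; _%_)
open import Data.Product using (∃-syntax; _×_)
open import Relation.Binary.PropositionalEquality using (_≡_)

open import Data.Nat as ℕ using (zero; suc)
import Data.Nat.Properties as ℕₚ
open import Data.Integer as ℤ using (ℤ; 0ℤ; 1ℤ; -1ℤ)
import Data.Integer.Properties as ℤₚ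
open import Data.Fin as Fin using (Fin; zero; suc)
import Data.Fin.Properties as Finₚ
open import Data.Bool using (Bool; true; false)
open import Data.Product using (_,_; proj₁; proj₂)
open import Data.Sum using (_⊎_; inj₁; inj₂)
open import Data.Empty using (⊥)
open import Function using (_∘_)
open import Relation.Nullary using (¬_; Dec; yes; no; does; contradiction)
open import Relation.Binary.Definitions using (tri<; tri≈; tri>)
import Relation.Binary.PropositionalEquality as ≡
open ≡ using (_≢_)
open import Algebra.Bundles using (CommutativeRing)

module ℤSum where
  open import Data.Integer using (+_; -[1+_]; _+_; _*_; -_; _-_; _≤_)
  open import Data.Integer.Properties
  open import Data.Integer.Tactic.RingSolver using (solve-∀)
  open import Data.Fin.Permutation using (permutation)
  open import Data.List using (List; []; _∷_; length; map; allFin; tabulate)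
  open import Data.List.Properties using (map-tabulate)
  open import Data.Nat.ListAction using () renaming (sum to listSum)
  open import Data.Vec using (lookup) renaming ([] to []ᵥ; _∷_ to _∷ᵥ_)
  open import Data.Fin.Subset using (Subset; ∣_∣)
  open import Function using (id)
  open import Data.List.Relation.Unary.Any using (here; there)
  open import Relation.Nullary.Decidable using (dec-true; dec-false)
  open ≡ using (refl; sym; trans; cong; cong₂; subst; module ≡-Reasoning)
  open import Algebra.Properties.Semiring.Sum +-*-semiring public
    using (sum; sum-cong-≗; ∑-distrib-+; ∑-comm; ∑-permute; *-distribˡ-sum; *-distribʳ-sum)

  sum-const : ∀ n c → sum {n} (λ _ → c) ≡ + n * c
  sum-const zero    c = sym (*-zeroˡ c)
  sum-const (suc n) c = trans (cong (_+_ c) (sum-const n c)) (sym (suc-* (+ n) c))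

  sum-zero : ∀ n → sum {n} (λ _ → 0ℤ) ≡ 0ℤ
  sum-zero n = trans (sum-const n 0ℤ) (*-zeroʳ (+ n))

  sum-*ˡ : ∀ {n} c (f : Fin n → ℤ) → sum (λ i → c * f i) ≡ c * sum f
  sum-*ˡ c f = sym (*-distribˡ-sum c f)

  sum-*ʳ : ∀ {n} c (f : Fin n → ℤ) → sum (λ i → f i * c) ≡ sum f * c
  sum-*ʳ c f = sym (*-distribʳ-sum c f)

  sum-*-sum : ∀ {m n} (f : Fin m → ℤ) (g : Fin n → ℤ) → sum f * sum g ≡ sum (λ i → sum (λ j → f i * g j))
  sum-*-sum f g = trans (*-distribʳ-sum (sum g) f) (sum-cong-≗ (λ i → *-distribˡ-sum (f i) g))

  sum-neg : ∀ {n} (f : Fin n → ℤ) → sum (λ i → - f i) ≡ - sum f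
  sum-neg {zero}  f = refl
  sum-neg {suc n} f = trans (cong (_+_ (- f zero)) (sum-neg (f ∘ suc))) (sym (neg-distrib-+ (f zero) _))

  ∑-distrib-- : ∀ {n} (f g : Fin n → ℤ) → sum (λ i → f i - g i) ≡ sum f - sum g
  ∑-distrib-- f g = trans (∑-distrib-+ f (λ i → - g i)) (cong (_+_ (sum f)) (sum-neg g))

  sum-a+b-2c : ∀ {n} a b c (u v w : Fin n → ℤ) →
    sum (λ i → a * u i + (b * v i - + 2 * (c * w i))) ≡ a * sum u + (b * sum v - + 2 * (c * sum w))
  sum-a+b-2c a b c u v w = begin
    sum (λ i → a * u i + (b * v i - + 2 * (c * w i)))
      ≡⟨ ∑-distrib-+ (λ i → a * u i) _ ⟩
    sum (λ i → a * u i) + sum (λ i → b * v i - + 2 * (c * w i))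
      ≡⟨ cong (_+_ (sum (λ i → a * u i))) (∑-distrib-- (λ i → b * v i) _) ⟩
    sum (λ i → a * u i) + (sum (λ i → b * v i) - sum (λ i → + 2 * (c * w i)))
      ≡⟨ cong₂ (λ x y → x + (sum (λ i → b * v i) - y)) (sum-*ˡ a u)
                (trans (sum-*ˡ (+ 2) (λ i → c * w i)) (cong (+ 2 *_) (sum-*ˡ c w))) ⟩
    a * sum u + (sum (λ i → b * v i) - + 2 * (c * sum w))
      ≡⟨ cong (λ x → a * sum u + (x - + 2 * (c * sum w))) (sum-*ˡ b v) ⟩
    a * sum u + (b * sum v - + 2 * (c * sum w)) ∎
    where open ≡-Reasoning

  sum-reindex : ∀ {n} (σ τ : Fin n → Fin n) → (∀ x → σ (τ x) ≡ x) → (∀ x → τ (σ x) ≡ x) →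
                (g : Fin n → ℤ) → sum (g ∘ σ) ≡ sum g
  sum-reindex σ τ στ τσ g = sym (∑-permute g (permutation σ τ στ τσ))

  sum-mono-≤ : ∀ {n} {f g : Fin n → ℤ} → (∀ i → f i ≤ g i) → sum f ≤ sum g
  sum-mono-≤ {zero}  f≤g = ≤-refl
  sum-mono-≤ {suc n} f≤g = +-mono-≤ (f≤g zero) (sum-mono-≤ (f≤g ∘ suc))

  sum-≤-const : ∀ {n} {f : Fin n → ℤ} c → (∀ i → f i ≤ c) → sum f ≤ + n * c
  sum-≤-const {n} {f} c f≤c = subst (sum f ≤_) (sum-const n c) (sum-mono-≤ f≤c)

  sum-nonNeg : ∀ {n} {f : Fin n → ℤ} → (∀ i → 0ℤ ≤ f i) → 0ℤ ≤ sum f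
  sum-nonNeg {n} {f} 0≤f = subst (_≤ sum f) (sum-zero n) (sum-mono-≤ 0≤f)

  sum-nonNeg≡0⇒≡0 : ∀ {n} {f : Fin n → ℤ} → (∀ i → 0ℤ ≤ f i) → sum f ≡ 0ℤ → ∀ i → f i ≡ 0ℤ
  sum-nonNeg≡0⇒≡0 {suc n} {f} 0≤f ∑f≡0 = vanish
    where
    rest = sum (f ∘ suc)
    head≡0 : f zero ≡ 0ℤ
    head≡0 = ≤-antisym (subst (f zero ≤_) ∑f≡0 (i≤i+j (f zero) rest {{ℤ.nonNegative (sum-nonNeg (0≤f ∘ suc))}})) (0≤f zero)
    vanish : ∀ i → f i ≡ 0ℤ
    vanish zero    = head≡0
    vanish (suc i) = sum-nonNeg≡0⇒≡0 (0≤f ∘ suc) (trans (sym (+-identityˡ rest)) (trans (cong (_+ rest) (sym head≡0)) ∑f≡0)) i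

  *-nonNeg : ∀ {a b} → 0ℤ ≤ a → 0ℤ ≤ b → 0ℤ ≤ a * b
  *-nonNeg {a} {b} 0≤a 0≤b = subst (_≤ a * b) (*-zeroʳ a) (*-monoˡ-≤-nonNeg a {{ℤ.nonNegative 0≤a}} 0≤b)

  square-nonNeg : ∀ x → 0ℤ ≤ x * x
  square-nonNeg (+ n)      = *-nonNeg {+ n} {+ n} (ℤ.+≤+ ℕ.z≤n) (ℤ.+≤+ ℕ.z≤n)
  square-nonNeg -[1+ n ]   = ℤ.+≤+ ℕ.z≤n

  -- Lagrange's identity: Σᵢ Σⱼ wᵢ wⱼ (Xᵢ − Xⱼ)² = 2 ((Σ w)(Σ w X²) − (Σ w X)²).
  cauchy-schwarz : ∀ {n} (w X : Fin n → ℤ) → (∀ i → 0ℤ ≤ w i) →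
    sum (λ i → w i * X i) * sum (λ i → w i * X i) ≤ sum w * sum (λ i → w i * (X i * X i))
  cauchy-schwarz w X 0≤w = 0≤i-j⇒j≤i (half (subst (0ℤ ≤_) lagrange (sum-nonNeg λ i → sum-nonNeg (0≤G i))))
    where
    A = sum (λ i → w i * X i)
    B = sum w
    C = sum (λ i → w i * (X i * X i))
    G : Fin _ → Fin _ → ℤ
    G i j = w i * w j * ((X i - X j) * (X i - X j))
    0≤G : ∀ i j → 0ℤ ≤ G i j
    0≤G i j = *-nonNeg (*-nonNeg (0≤w i) (0≤w j)) (square-nonNeg (X i - X j))
    half : ∀ {y} → 0ℤ ≤ + 2 * y → 0ℤ ≤ y
    half {+ _}      _  = ℤ.+≤+ ℕ.z≤n
    half { -[1+ _ ]} ()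
    expand : ∀ a b x y → a * b * ((x - y) * (x - y)) ≡ a * (x * x) * b + (a * (b * (y * y)) - + 2 * (a * x * (b * y)))
    expand = solve-∀
    commute : ∀ b c a u v z → u * b + (v * c - + 2 * (z * a)) ≡ b * u + (c * v - + 2 * (a * z))
    commute = solve-∀
    regroup : ∀ a b c → c * b + (b * c - + 2 * (a * a)) ≡ + 2 * (c * b - a * a)
    regroup = solve-∀
    lagrange : sum (λ i → sum (G i)) ≡ + 2 * (B * C - A * A)
    lagrange = begin
      sum (λ i → sum (G i))
        ≡⟨ sum-cong-≗ (λ i → trans (sum-cong-≗ (λ j → expand (w i) (w j) (X i) (X j)))
                                   (sum-a+b-2c (w i * (X i * X i)) (w i) (w i * X i) w (λ j → w j * (X j * X j)) (λ j → w j * X j))) ⟩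
      sum (λ i → w i * (X i * X i) * B + (w i * C - + 2 * (w i * X i * A)))
        ≡⟨ sum-cong-≗ (λ i → commute B C A (w i * (X i * X i)) (w i) (w i * X i)) ⟩
      sum (λ i → B * (w i * (X i * X i)) + (C * w i - + 2 * (A * (w i * X i))))
        ≡⟨ sum-a+b-2c B C A (λ i → w i * (X i * X i)) w (λ i → w i * X i) ⟩
      B * C + (C * B - + 2 * (A * A))
        ≡⟨ regroup A C B ⟩
      + 2 * (B * C - A * A) ∎
      where open ≡-Reasoning

  bit : Bool → ℤ
  bit true  = 1ℤ
  bit false = 0ℤ

  bit-nonNeg : ∀ b → 0ℤ ≤ bit b
  bit-nonNeg true  = ℤ.+≤+ ℕ.z≤n
  bit-nonNeg false = ℤ.+≤+ ℕ.z≤n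

  bit≤1 : ∀ b → bit b ≤ 1ℤ
  bit≤1 true  = ≤-refl
  bit≤1 false = ℤ.+≤+ ℕ.z≤n

  𝟙 : ∀ {P : Set} → Dec P → ℤ
  𝟙 d = bit (does d)

  𝟙-yes : ∀ {P : Set} (d : Dec P) → P → 𝟙 d ≡ 1ℤ
  𝟙-yes d p = cong bit (dec-true d p)

  𝟙-no : ∀ {P : Set} (d : Dec P) → ¬ P → 𝟙 d ≡ 0ℤ
  𝟙-no d ¬p = cong bit (dec-false d ¬p)

  δ : ∀ {n} → Fin n → Fin n → ℤ
  δ i j = 𝟙 (i Fin.≟ j)

  δ-nonNeg : ∀ {n} (i j : Fin n) → 0ℤ ≤ δ i j
  δ-nonNeg i j = bit-nonNeg (does (i Fin.≟ j))

  δ-refl : ∀ {n} (i : Fin n) → δ i i ≡ 1ℤ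
  δ-refl i = 𝟙-yes (i Fin.≟ i) refl

  δ-≢ : ∀ {n} {i j : Fin n} → i ≢ j → δ i j ≡ 0ℤ
  δ-≢ {i = i} {j} = 𝟙-no (i Fin.≟ j)

  δ-sym : ∀ {n} (i j : Fin n) → δ i j ≡ δ j i
  δ-sym i j with i Fin.≟ j | j Fin.≟ i
  ... | yes _   | yes _   = refl
  ... | no  _   | no  _   = refl
  ... | yes i≡j | no  j≢i = contradiction (sym i≡j) j≢i
  ... | no  i≢j | yes j≡i = contradiction (sym j≡i) i≢j

  sum-δ : ∀ {n} (w : Fin n) → sum (λ i → δ i w) ≡ 1ℤ
  sum-δ {suc n} zero    = cong (_+_ 1ℤ) (trans (sum-cong-≗ {n} {λ i → δ (suc i) zero} (λ i → δ-≢ {i = suc i} {zero} λ ())) (sum-zero n))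
  sum-δ {suc n} (suc w) = trans (+-identityˡ _) (sum-δ w)

  sum-δ-* : ∀ {n} (w : Fin n) (g : Fin n → ℤ) → sum (λ i → δ i w * g i) ≡ g w
  sum-δ-* w g = begin
    sum (λ i → δ i w * g i) ≡⟨ sum-cong-≗ pointwise ⟩
    sum (λ i → δ i w * g w) ≡⟨ sum-*ʳ (g w) (λ i → δ i w) ⟩
    sum (λ i → δ i w) * g w ≡⟨ cong (_* g w) (sum-δ w) ⟩
    1ℤ * g w                ≡⟨ *-identityˡ (g w) ⟩
    g w                     ∎
    where
    open ≡-Reasoning
    pointwise : ∀ i → δ i w * g i ≡ δ i w * g w
    pointwise i with i Fin.≟ w
    ... | yes refl = refl
    ... | no  _    = refl

  listSum-allFin : ∀ {n} (h : Fin n → ℕ) → + listSum (map h (allFin n)) ≡ sum (λ i → + h i)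
  listSum-allFin h = trans (cong (λ l → + listSum l) (map-tabulate id h)) (tabulated h)
    where
    tabulated : ∀ {n} (h : Fin n → ℕ) → + listSum (tabulate h) ≡ sum (λ i → + h i)
    tabulated {zero}  h = refl
    tabulated {suc n} h = cong (_+_ (+ h zero)) (tabulated (h ∘ suc))

  ∣_∣-as-sum : ∀ {n} (S : Subset n) → + ∣ S ∣ ≡ sum (λ i → bit (lookup S i))
  ∣ []ᵥ        ∣-as-sum = refl
  ∣ true ∷ᵥ S  ∣-as-sum = cong (_+_ 1ℤ) (∣ S ∣-as-sum)
  ∣ false ∷ᵥ S ∣-as-sum = trans (∣ S ∣-as-sum) (sym (+-identityˡ _))

  module _ {n : ℕ} where
    open import Data.List.Membership.DecPropositional (Fin._≟_ {n}) using (_∈_; _∉_; _∈?_)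

    occurrences : List (Fin n) → Fin n → ℤ
    occurrences []      s = 0ℤ
    occurrences (e ∷ E) s = δ s e + occurrences E s

    occurrences-nonNeg : ∀ E s → 0ℤ ≤ occurrences E s
    occurrences-nonNeg []      s = ≤-refl
    occurrences-nonNeg (e ∷ E) s = +-mono-≤ (δ-nonNeg s e) (occurrences-nonNeg E s)

    ∈⇒1≤occurrences : ∀ {E s} → s ∈ E → 1ℤ ≤ occurrences E s
    ∈⇒1≤occurrences {e ∷ E} {s} (here refl) =
      subst (_≤ δ s s + occurrences E s) (+-identityʳ 1ℤ) (+-mono-≤ (≤-reflexive (sym (δ-refl s))) (occurrences-nonNeg E s))
    ∈⇒1≤occurrences {e ∷ E} {s} (there s∈E) =
      subst (_≤ δ s e + occurrences E s) (+-identityˡ 1ℤ) (+-mono-≤ (δ-nonNeg s e) (∈⇒1≤occurrences s∈E))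

    sum-occurrences : ∀ E → sum (occurrences E) ≡ + length E
    sum-occurrences []      = sum-zero n
    sum-occurrences (e ∷ E) = trans (∑-distrib-+ (λ s → δ s e) (occurrences E)) (cong₂ _+_ (sum-δ e) (sum-occurrences E))

    sum-≤-off : ∀ E {g h : Fin n → ℤ} → (∀ s → g s ≤ 1ℤ) → (∀ s → -1ℤ ≤ h s) →
                (∀ s → s ∉ E → g s ≡ h s) → sum g ≤ sum h + + 2 * + length E
    sum-≤-off E {g} {h} g≤1 -1≤h g≡h = begin
      sum g                                   ≤⟨ sum-mono-≤ pointwise ⟩
      sum (λ s → h s + + 2 * occurrences E s) ≡⟨ ∑-distrib-+ h (λ s → + 2 * occurrences E s) ⟩
      sum h + sum (λ s → + 2 * occurrences E s) ≡⟨ cong (_+_ (sum h)) (trans (sum-*ˡ (+ 2) (occurrences E)) (cong (_*_ (+ 2)) (sum-occurrences E))) ⟩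
      sum h + + 2 * + length E                ∎
      where
      open ≤-Reasoning
      pointwise : ∀ s → g s ≤ h s + + 2 * occurrences E s
      pointwise s with s ∈? E
      ... | no  s∉E = subst (_≤ h s + + 2 * occurrences E s) (sym (g≡h s s∉E))
                        (i≤i+j (h s) (+ 2 * occurrences E s) {{ℤ.nonNegative (*-nonNeg {+ 2} (ℤ.+≤+ ℕ.z≤n) (occurrences-nonNeg E s))}})
      ... | yes s∈E = ≤-trans (g≤1 s) (+-mono-≤ (-1≤h s) (*-monoˡ-≤-nonNeg (+ 2) (∈⇒1≤occurrences s∈E)))

  UnitBounded : ℤ → Set
  UnitBounded v = ℤ.∣ v ∣ ℕ.≤ 1

  unitBounded-* : ∀ {a b} → UnitBounded a → UnitBounded b → UnitBounded (a * b)
  unitBounded-* {a} {b} ∣a∣≤1 ∣b∣≤1 = subst (ℕ._≤ 1) (sym (abs-* a b)) (ℕₚ.*-mono-≤ ∣a∣≤1 ∣b∣≤1)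

  unitBounded-neg : ∀ {a} → UnitBounded a → UnitBounded (- a)
  unitBounded-neg {a} = subst (ℕ._≤ 1) (sym (∣-i∣≡∣i∣ a))

  unitBounded⇒≤1 : ∀ {a} → UnitBounded a → a ≤ 1ℤ
  unitBounded⇒≤1 {+ n}      n≤1 = ℤ.+≤+ n≤1
  unitBounded⇒≤1 { -[1+ n ]} _   = ℤ.-≤+

  unitBounded⇒-1≤ : ∀ {a} → UnitBounded a → -1ℤ ≤ a
  unitBounded⇒-1≤ {+ n}          _          = ℤ.-≤+
  unitBounded⇒-1≤ { -[1+ 0 ]}     _          = ≤-refl
  unitBounded⇒-1≤ { -[1+ suc n ]} (ℕ.s≤s ())

-- The solver is instantiated with integer coefficients: with coefficients taken from R itself,
-- normalisation would have to decide equalities between symbolic ring elements.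
module IntegerCoefficients {c ℓ} (R : CommutativeRing c ℓ) where
  open import Data.Integer using (+_; -[1+_]; _⊖_)
  open import Data.Maybe using (Maybe; just; nothing)
  open CommutativeRing R
  open import Algebra.Properties.Ring ring using (-‿distribˡ-*; -‿distribʳ-*; -‿involutive; -0#≈0#; -‿+-comm)
  open import Algebra.Properties.Semiring.Mult semiring using (×-homo-+; ×1-homo-*) renaming (_×_ to _×ₙ_)
  open import Algebra.Properties.CommutativeSemigroup +-commutativeSemigroup using (interchange)
  open import Algebra.Solver.Ring.AlmostCommutativeRing using (fromCommutativeRing; _-Raw-AlmostCommutative⟶_)
  open import Relation.Binary.Reasoning.Setoid setoid

  fromℤ : ℤ → Carrier
  fromℤ (+ n)      = n ×ₙ 1#
  fromℤ -[1+ n ]   = - (suc n ×ₙ 1#)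

  fromℤ-⊖ : ∀ m n → fromℤ (m ⊖ n) ≈ m ×ₙ 1# - n ×ₙ 1#
  fromℤ-⊖ m       zero    = begin
    m ×ₙ 1#                          ≈⟨ +-identityʳ (m ×ₙ 1#) ⟨
    m ×ₙ 1# + 0#                     ≈⟨ +-congˡ -0#≈0# ⟨
    m ×ₙ 1# - 0#                     ∎
  fromℤ-⊖ zero    (suc n) = sym (+-identityˡ _)
  fromℤ-⊖ (suc m) (suc n) = begin
    fromℤ (suc m ⊖ suc n)            ≡⟨ ≡.cong fromℤ (ℤₚ.[1+m]⊖[1+n]≡m⊖n m n) ⟩
    fromℤ (m ⊖ n)                    ≈⟨ fromℤ-⊖ m n ⟩
    m ×ₙ 1# - n ×ₙ 1#                ≈⟨ +-identityˡ _ ⟨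
    0# + (m ×ₙ 1# - n ×ₙ 1#)         ≈⟨ +-congʳ (-‿inverseʳ 1#) ⟨
    (1# - 1#) + (m ×ₙ 1# - n ×ₙ 1#)  ≈⟨ interchange 1# (- 1#) (m ×ₙ 1#) (- (n ×ₙ 1#)) ⟩
    (1# + m ×ₙ 1#) + (- 1# - n ×ₙ 1#) ≈⟨ +-congˡ (-‿+-comm 1# (n ×ₙ 1#)) ⟩
    (1# + m ×ₙ 1#) - (1# + n ×ₙ 1#)  ∎

  fromℤ-homo-- : ∀ i → fromℤ (ℤ.- i) ≈ - fromℤ i
  fromℤ-homo-- (+ zero)  = sym -0#≈0#
  fromℤ-homo-- (+ suc n) = refl
  fromℤ-homo-- -[1+ n ]  = sym (-‿involutive _)

  fromℤ-homo-+ : ∀ i j → fromℤ (i ℤ.+ j) ≈ fromℤ i + fromℤ j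
  fromℤ-homo-+ (+ m)    (+ n)    = ×-homo-+ 1# m n
  fromℤ-homo-+ (+ m)    -[1+ n ] = fromℤ-⊖ m (suc n)
  fromℤ-homo-+ -[1+ m ] (+ n)    = trans (fromℤ-⊖ n (suc m)) (+-comm _ _)
  fromℤ-homo-+ -[1+ m ] -[1+ n ] = begin
    - (1# + (1# + (m ℕ.+ n) ×ₙ 1#))  ≡⟨ ≡.cong (λ k → - (k ×ₙ 1#)) (ℕₚ.+-suc (suc m) n) ⟨
    - ((suc m ℕ.+ suc n) ×ₙ 1#)      ≈⟨ -‿cong (×-homo-+ 1# (suc m) (suc n)) ⟩
    - (suc m ×ₙ 1# + suc n ×ₙ 1#)    ≈⟨ -‿+-comm (suc m ×ₙ 1#) (suc n ×ₙ 1#) ⟨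
    - (suc m ×ₙ 1#) - suc n ×ₙ 1#    ∎

  fromℤ-homo-*-+ : ∀ m n → fromℤ (+ m ℤ.* + n) ≈ m ×ₙ 1# * n ×ₙ 1#
  fromℤ-homo-*-+ m n = trans (reflexive (≡.cong fromℤ (≡.sym (ℤₚ.pos-* m n)))) (×1-homo-* m n)

  fromℤ-homo-* : ∀ i j → fromℤ (i ℤ.* j) ≈ fromℤ i * fromℤ j
  fromℤ-homo-* (+ m)    (+ n)    = fromℤ-homo-*-+ m n
  fromℤ-homo-* (+ m)    -[1+ n ] = begin
    fromℤ (+ m ℤ.* ℤ.- + suc n)      ≡⟨ ≡.cong fromℤ (ℤₚ.neg-distribʳ-* (+ m) (+ suc n)) ⟨
    fromℤ (ℤ.- (+ m ℤ.* + suc n))    ≈⟨ fromℤ-homo-- (+ m ℤ.* + suc n) ⟩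
    - fromℤ (+ m ℤ.* + suc n)        ≈⟨ -‿cong (fromℤ-homo-*-+ m (suc n)) ⟩
    - (m ×ₙ 1# * suc n ×ₙ 1#)        ≈⟨ -‿distribʳ-* (m ×ₙ 1#) (suc n ×ₙ 1#) ⟩
    m ×ₙ 1# * - (suc n ×ₙ 1#)        ∎
  fromℤ-homo-* -[1+ m ] (+ n)    = begin
    fromℤ (ℤ.- + suc m ℤ.* + n)      ≡⟨ ≡.cong fromℤ (ℤₚ.neg-distribˡ-* (+ suc m) (+ n)) ⟨
    fromℤ (ℤ.- (+ suc m ℤ.* + n))    ≈⟨ fromℤ-homo-- (+ suc m ℤ.* + n) ⟩
    - fromℤ (+ suc m ℤ.* + n)        ≈⟨ -‿cong (fromℤ-homo-*-+ (suc m) n) ⟩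
    - (suc m ×ₙ 1# * n ×ₙ 1#)        ≈⟨ -‿distribˡ-* (suc m ×ₙ 1#) (n ×ₙ 1#) ⟩
    - (suc m ×ₙ 1#) * n ×ₙ 1#        ∎
  fromℤ-homo-* -[1+ m ] -[1+ n ] = begin
    fromℤ (+ suc m ℤ.* + suc n)      ≈⟨ fromℤ-homo-*-+ (suc m) (suc n) ⟩
    a * b                            ≈⟨ *-congʳ (-‿involutive a) ⟨
    - - a * b                        ≈⟨ -‿distribˡ-* (- a) b ⟨
    - (- a * b)                      ≈⟨ -‿distribʳ-* (- a) b ⟩
    - a * - b                        ∎
    where
    a = suc m ×ₙ 1#
    b = suc n ×ₙ 1#

  homomorphism : CommutativeRing.rawRing ℤₚ.+-*-commutativeRing -Raw-AlmostCommutative⟶ fromCommutativeRing R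
  homomorphism = record
    { ⟦_⟧    = fromℤ
    ; +-homo = fromℤ-homo-+
    ; *-homo = fromℤ-homo-*
    ; -‿homo = fromℤ-homo--
    ; 0-homo = refl
    ; 1-homo = +-identityʳ 1#
    }

  private
    coefficients≟ : ∀ i j → Maybe (fromℤ i ≈ fromℤ j)
    coefficients≟ i j with i ℤ.≟ j
    ... | yes ≡.refl = just refl
    ... | no  _      = nothing

  open import Algebra.Solver.Ring _ _ homomorphism coefficients≟ public
    using (solve; _:=_; _:+_; _:*_; :-_; _:-_)

module FieldProperties {q : ℕ} (𝔽 : FiniteField q) where
  open FiniteField 𝔽 public
  open ℤSum using (sum; sum-const; sum-nonNeg; sum-cong-≗; ∑-distrib-+; sum-reindex; bit-nonNeg; 𝟙; 𝟙-yes; 𝟙-no)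
  open ≡ using (refl; sym; trans; cong; cong₂; subst; module ≡-Reasoning)
  open import Data.Nat.DivMod using (m*n%n≡0)

  ∑ : (Fin q → ℤ) → ℤ
  ∑ = sum

  commutativeRing : CommutativeRing _ _
  commutativeRing = record { isCommutativeRing = isCommutativeRing }

  open CommutativeRing commutativeRing public
    using (+-assoc; +-comm; *-assoc; *-comm; +-identityˡ; +-identityʳ; *-identityˡ; *-identityʳ;
           zeroˡ; zeroʳ; -‿inverseˡ; -‿inverseʳ; distribʳ; _-_)
  open import Algebra.Properties.Ring (CommutativeRing.ring commutativeRing) public
    using (-‿involutive; -0#≈0#; x∙y⁻¹≈ε⇒x≈y; +-cancelʳ)
  open IntegerCoefficients commutativeRing public using (solve; _:=_; _:+_; _:*_; :-_; _:-_)

  1≢0 : 1# ≢ 0#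
  1≢0 1≡0 = 0≢1 (sym 1≡0)

  -- Total inverse, with the junk value 0 ⁻¹ = 0.
  _⁻¹ : Fin q → Fin q
  x ⁻¹ with x ≟ 0#
  ... | yes _   = 0#
  ... | no  x≢0 = proj₁ (inverse x x≢0)

  ⁻¹-inverseʳ : ∀ {x} → x ≢ 0# → x * x ⁻¹ ≡ 1#
  ⁻¹-inverseʳ {x} x≢0 with x ≟ 0#
  ... | yes x≡0 = contradiction x≡0 x≢0
  ... | no  x≢0 = proj₂ (inverse x x≢0)

  ⁻¹-inverseˡ : ∀ {x} → x ≢ 0# → x ⁻¹ * x ≡ 1#
  ⁻¹-inverseˡ {x} x≢0 = trans (*-comm (x ⁻¹) x) (⁻¹-inverseʳ x≢0)

  0⁻¹≡0 : 0# ⁻¹ ≡ 0#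
  0⁻¹≡0 with 0# ≟ 0#
  ... | yes _   = refl
  ... | no  0≢0 = contradiction refl 0≢0

  *-cancelˡ : ∀ {x} a b → x ≢ 0# → x * a ≡ x * b → a ≡ b
  *-cancelˡ {x} a b x≢0 xa≡xb = begin
    a                ≡⟨ sym (*-identityˡ a) ⟩
    1# * a           ≡⟨ cong (_* a) (sym (⁻¹-inverseˡ x≢0)) ⟩
    (x ⁻¹ * x) * a   ≡⟨ *-assoc (x ⁻¹) x a ⟩
    x ⁻¹ * (x * a)   ≡⟨ cong (x ⁻¹ *_) xa≡xb ⟩
    x ⁻¹ * (x * b)   ≡⟨ sym (*-assoc (x ⁻¹) x b) ⟩
    (x ⁻¹ * x) * b   ≡⟨ cong (_* b) (⁻¹-inverseˡ x≢0) ⟩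
    1# * b           ≡⟨ *-identityˡ b ⟩
    b                ∎
    where open ≡-Reasoning

  *-≢0 : ∀ {x y} → x ≢ 0# → y ≢ 0# → x * y ≢ 0#
  *-≢0 {x} {y} x≢0 y≢0 xy≡0 = y≢0 (*-cancelˡ y 0# x≢0 (trans xy≡0 (sym (zeroʳ x))))

  ⁻¹-≢0 : ∀ {x} → x ≢ 0# → x ⁻¹ ≢ 0#
  ⁻¹-≢0 {x} x≢0 x⁻¹≡0 = 1≢0 (trans (sym (⁻¹-inverseʳ x≢0)) (trans (cong (x *_) x⁻¹≡0) (zeroʳ x)))

  ⁻¹-involutive : ∀ x → x ⁻¹ ⁻¹ ≡ x
  ⁻¹-involutive x = by-cases (x ≟ 0#)
    where
    by-cases : Dec (x ≡ 0#) → x ⁻¹ ⁻¹ ≡ x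
    by-cases (yes refl) = trans (cong _⁻¹ 0⁻¹≡0) 0⁻¹≡0
    by-cases (no x≢0)   = *-cancelˡ (x ⁻¹ ⁻¹) x (⁻¹-≢0 x≢0) (trans (⁻¹-inverseʳ (⁻¹-≢0 x≢0)) (sym (⁻¹-inverseˡ x≢0)))

  zero-product : ∀ {x y} → x * y ≡ 0# → x ≡ 0# ⊎ y ≡ 0#
  zero-product {x} {y} xy≡0 with x ≟ 0# | y ≟ 0#
  ... | yes x≡0 | _       = inj₁ x≡0
  ... | no  _   | yes y≡0 = inj₂ y≡0
  ... | no  x≢0 | no  y≢0 = contradiction xy≡0 (*-≢0 x≢0 y≢0)

  -- In characteristic 2, x ↦ x + 1 is a fixed-point-free involution, so it pairs off the elements of Fin q.
  1+1≡0⇒even : 1# + 1# ≡ 0# → ∃[ k ] q ≡ k ℕ.* 2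
  1+1≡0⇒even 1+1≡0 with ∑ below | sum-nonNeg {f = below} (λ x → bit-nonNeg (does (x Finₚ.<? σ x))) | pairing
    where
    σ : Fin q → Fin q
    σ x = x + 1#
    σ-involutive : ∀ x → σ (σ x) ≡ x
    σ-involutive x = trans (+-assoc x 1# 1#) (trans (cong (x +_) 1+1≡0) (+-identityʳ x))
    σ-fixpointFree : ∀ x → σ x ≢ x
    σ-fixpointFree x x+1≡x = 1≢0 (+-cancelʳ x 1# 0# (trans (+-comm 1# x) (trans x+1≡x (sym (+-identityˡ x)))))
    below : Fin q → ℤ
    below x = 𝟙 (x Finₚ.<? σ x)
    below-pair : ∀ x → below x ℤ.+ below (σ x) ≡ 1ℤ
    below-pair x with Finₚ.<-cmp x (σ x)
    ... | tri< x<σx _ _ = cong₂ ℤ._+_ (𝟙-yes (x Finₚ.<? σ x) x<σx)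
                            (𝟙-no (σ x Finₚ.<? σ (σ x)) (λ σx<σσx → Finₚ.<-asym x<σx (subst (σ x Fin.<_) (σ-involutive x) σx<σσx)))
    ... | tri≈ _ x≡σx _ = contradiction (sym x≡σx) (σ-fixpointFree x)
    ... | tri> _ _ σx<x = cong₂ ℤ._+_ (𝟙-no (x Finₚ.<? σ x) (Finₚ.<-asym σx<x))
                            (𝟙-yes (σ x Finₚ.<? σ (σ x)) (subst (σ x Fin.<_) (sym (σ-involutive x)) σx<x))
    pairing : ℤ.+ q ≡ ∑ below ℤ.+ ∑ below
    pairing = begin
      ℤ.+ q                              ≡⟨ sym (ℤₚ.*-identityʳ (ℤ.+ q)) ⟩
      ℤ.+ q ℤ.* 1ℤ                       ≡⟨ sym (sum-const q 1ℤ) ⟩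
      ∑ (λ _ → 1ℤ)                       ≡⟨ sym (sum-cong-≗ below-pair) ⟩
      ∑ (λ x → below x ℤ.+ below (σ x))  ≡⟨ ∑-distrib-+ below (below ∘ σ) ⟩
      ∑ below ℤ.+ ∑ (below ∘ σ)          ≡⟨ cong (ℤ._+_ (∑ below)) (sum-reindex σ σ σ-involutive σ-involutive below) ⟩
      ∑ below ℤ.+ ∑ below                ∎
      where open ≡-Reasoning
  ... | ℤ.+ k | _ | q≡k+k = k , trans (ℤₚ.+-injective q≡k+k) (trans (cong (k ℕ.+_) (sym (ℕₚ.+-identityʳ k))) (ℕₚ.*-comm 2 k))

  odd⇒1+1≢0 : q % 2 ≡ 1 → 1# + 1# ≢ 0#
  odd⇒1+1≢0 q%2≡1 1+1≡0 with 1+1≡0⇒even 1+1≡0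
  ... | k , refl = ℕₚ.0≢1+n (trans (sym (m*n%n≡0 k 2)) q%2≡1)

module Admissibility {q : ℕ} (𝔽 : FiniteField q) where
  open FieldProperties 𝔽
  open ≡ using (refl; sym; trans; cong; cong₂; subst; module ≡-Reasoning)
  open import Data.Nat using (_≤_; _<_; _∸_; z≤n; s≤s)
  open import Data.Sum using ([_,_]′) renaming (map to ⊎-map)
  open import Function using (id)
  open import Relation.Nullary.Decidable using (decidable-stable)

  Σ≤-cong : ∀ n {g h : ℕ → Fin q} → (∀ k → k ≤ n → g k ≡ h k) → Σ≤ n g ≡ Σ≤ n h
  Σ≤-cong zero    g≡h = g≡h 0 z≤n
  Σ≤-cong (suc n) g≡h = cong₂ _+_ (Σ≤-cong n (λ k k≤n → g≡h k (ℕₚ.m≤n⇒m≤1+n k≤n))) (g≡h (suc n) ℕₚ.≤-refl)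

  Σ≤-vanish : ∀ n (g : ℕ → Fin q) → (∀ k → k ≤ n → g k ≡ 0#) → Σ≤ n g ≡ 0#
  Σ≤-vanish zero    g g≡0 = g≡0 0 z≤n
  Σ≤-vanish (suc n) g g≡0 =
    trans (cong₂ _+_ (Σ≤-vanish n g (λ k k≤n → g≡0 k (ℕₚ.m≤n⇒m≤1+n k≤n))) (g≡0 (suc n) ℕₚ.≤-refl)) (+-identityˡ 0#)

  Σ≤-single : ∀ n {m} (g : ℕ → Fin q) → m ≤ n → (∀ k → k ≤ n → k ≢ m → g k ≡ 0#) → Σ≤ n g ≡ g m
  Σ≤-single zero    g z≤n others = refl
  Σ≤-single (suc n) {m} g m≤1+n others with m ℕₚ.≟ suc n
  ... | yes refl  = trans (cong (_+ g (suc n)) (Σ≤-vanish n g (λ k k≤n → others k (ℕₚ.m≤n⇒m≤1+n k≤n) (ℕₚ.<⇒≢ (s≤s k≤n)))))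
                          (+-identityˡ (g (suc n)))
  ... | no  m≢1+n = trans (cong₂ _+_ (Σ≤-single n g m≤n (λ k k≤n → others k (ℕₚ.m≤n⇒m≤1+n k≤n)))
                                     (others (suc n) ℕₚ.≤-refl (m≢1+n ∘ sym)))
                          (+-identityʳ (g m))
    where
    m≤n = ℕₚ.≤-pred (ℕₚ.≤∧≢⇒< m≤1+n m≢1+n)

  top-degree : ∀ (g : ℕ → Fin q) n → (∀ k → n < k → g k ≡ 0#) → ∀ {i} → g i ≢ 0# →
            ∃[ d ] (g d ≢ 0# × ∀ k → d < k → g k ≡ 0#)
  top-degree g zero    beyond {zero}  gi≢0 = 0 , gi≢0 , beyond
  top-degree g zero    beyond {suc i} gi≢0 = contradiction (beyond (suc i) (s≤s z≤n)) gi≢0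
  top-degree g (suc n) beyond gi≢0 with g (suc n) ≟ 0#
  ... | no  g≢0 = suc n , g≢0 , beyond
  ... | yes g≡0 = top-degree g n beyond′ gi≢0
    where
    beyond′ : ∀ k → n < k → g k ≡ 0#
    beyond′ k n<k with k ℕₚ.≟ suc n
    ... | yes refl  = g≡0
    ... | no  k≢1+n = beyond k (ℕₚ.≤∧≢⇒< n<k (k≢1+n ∘ sym))

  -- The product of the leading coefficients survives in the top degree, which is positive.
  nonconstant-not-unit : ∀ (p r : ℕ → Fin q) N M → (∀ k → N < k → p k ≡ 0#) → (∀ k → M < k → r k ≡ 0#) →
                         ∃[ i ] (i ≢ 0 × p i ≢ 0#) → p 0 * r 0 ≡ 1# →
                         ¬ (∀ n → n ≢ 0 → Σ≤ n (λ k → p k * r (n ∸ k)) ≡ 0#)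
  nonconstant-not-unit p r N M p-bounded r-bounded (i , i≢0 , pi≢0) p0r0≡1 higher≡0
    with top-degree p N p-bounded pi≢0 | top-degree r M r-bounded r0≢0
    where
    r0≢0 : r 0 ≢ 0#
    r0≢0 r0≡0 = 1≢0 (trans (sym p0r0≡1) (trans (cong (p 0 *_) r0≡0) (zeroʳ (p 0))))
  ... | d , pd≢0 , p-top | e , re≢0 , r-top = *-≢0 pd≢0 re≢0 (trans (sym top-coefficient) (higher≡0 (d ℕ.+ e) d+e≢0))
    where
    d≢0 : d ≢ 0
    d≢0 refl = pi≢0 (p-top i (ℕₚ.n≢0⇒n>0 i≢0))
    d+e≢0 : d ℕ.+ e ≢ 0
    d+e≢0 d+e≡0 = d≢0 (ℕₚ.m+n≡0⇒m≡0 d d+e≡0)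
    top-coefficient : Σ≤ (d ℕ.+ e) (λ k → p k * r (d ℕ.+ e ∸ k)) ≡ p d * r e
    top-coefficient = trans (Σ≤-single (d ℕ.+ e) (λ k → p k * r (d ℕ.+ e ∸ k)) (ℕₚ.m≤m+n d e) others)
                            (cong (λ k → p d * r k) (ℕₚ.m+n∸m≡n d e))
      where
      others : ∀ k → k ≤ d ℕ.+ e → k ≢ d → p k * r (d ℕ.+ e ∸ k) ≡ 0#
      others k k≤d+e k≢d with ℕₚ.<-cmp k d
      ... | tri≈ _ k≡d _ = contradiction k≡d k≢d
      ... | tri> _ _ d<k = trans (cong (_* r (d ℕ.+ e ∸ k)) (p-top k d<k)) (zeroˡ _)
      ... | tri< k<d _ _ = trans (cong (p k *_) (r-top (d ℕ.+ e ∸ k) e<d+e-k)) (zeroʳ (p k))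
        where
        e<d+e-k : e < d ℕ.+ e ∸ k
        e<d+e-k = ℕₚ.+-cancelʳ-< k e (d ℕ.+ e ∸ k)
                    (subst (e ℕ.+ k <_) (sym (ℕₚ.m∸n+n≡m k≤d+e)) (subst (_< d ℕ.+ e) (ℕₚ.+-comm k e) (ℕₚ.+-monoˡ-< e k<d)))

  𝟏 : Coeffs
  𝟏 zero    zero    = 1#
  𝟏 zero    (suc j) = 0#
  𝟏 (suc i) j       = 0#

  𝟏-vanish : ∀ i j → i ≢ 0 ⊎ j ≢ 0 → 𝟏 i j ≡ 0#
  𝟏-vanish zero    zero    (inj₁ 0≢0) = contradiction refl 0≢0
  𝟏-vanish zero    zero    (inj₂ 0≢0) = contradiction refl 0≢0
  𝟏-vanish zero    (suc j) _          = refl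
  𝟏-vanish (suc i) j       _          = refl

  𝟏-isPoly : IsPoly 𝟏
  𝟏-isPoly = 0 , λ i j → 𝟏-vanish i j ∘ ⊎-map ℕₚ.n>0⇒n≢0 ℕₚ.n>0⇒n≢0

  ∸≢0 : ∀ {j l} → l ≤ j → l ≢ j → j ∸ l ≢ 0
  ∸≢0 l≤j l≢j j∸l≡0 = l≢j (ℕₚ.≤-antisym l≤j (ℕₚ.m∸n≡0⇒m≤n j∸l≡0))

  ·-identityʳ : ∀ X → (X · 𝟏) ≐ X
  ·-identityʳ X i j = begin
    (X · 𝟏) i j                             ≡⟨ Σ≤-cong i (λ k _ → Σ≤-single j _ ℕₚ.≤-refl (off-column k)) ⟩
    Σ≤ i (λ k → X k j * 𝟏 (i ∸ k) (j ∸ j))  ≡⟨ Σ≤-single i _ ℕₚ.≤-refl off-row ⟩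
    X i j * 𝟏 (i ∸ i) (j ∸ j)               ≡⟨ cong₂ (λ a b → X i j * 𝟏 a b) (ℕₚ.n∸n≡0 i) (ℕₚ.n∸n≡0 j) ⟩
    X i j * 1#                              ≡⟨ *-identityʳ (X i j) ⟩
    X i j                                   ∎
    where
    open ≡-Reasoning
    off-column : ∀ k l → l ≤ j → l ≢ j → X k l * 𝟏 (i ∸ k) (j ∸ l) ≡ 0#
    off-column k l l≤j l≢j = trans (cong (X k l *_) (𝟏-vanish (i ∸ k) (j ∸ l) (inj₂ (∸≢0 l≤j l≢j)))) (zeroʳ (X k l))
    off-row : ∀ k → k ≤ i → k ≢ i → X k j * 𝟏 (i ∸ k) (j ∸ j) ≡ 0#
    off-row k k≤i k≢i = trans (cong (X k j *_) (𝟏-vanish (i ∸ k) (j ∸ j) (inj₁ (∸≢0 k≤i k≢i)))) (zeroʳ (X k j))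

  𝟏-constTimesSquare : ConstTimesSquare 𝟏
  𝟏-constTimesSquare = 1# , 𝟏 , 𝟏-isPoly , λ i j → sym (trans (*-identityˡ ((𝟏 · 𝟏) i j)) (·-identityʳ 𝟏 i j))

  -- Restricted to y = 0 (resp. x = 0), a factorisation 𝟏 = P · R is one of univariate polynomials.
  𝟏-primitiveInX : PrimitiveInX 𝟏
  𝟏-primitiveInX (P , R , ((N , P-bounded) , P∈F[x]) , (i , j , i≢0⊎j≢0 , Pij≢0) , (M , R-bounded) , 𝟏≐PR) =
    nonconstant-not-unit (λ k → P k 0) (λ k → R k 0) N M (λ k N<k → P-bounded k 0 (inj₁ N<k)) (λ k M<k → R-bounded k 0 (inj₁ M<k))
      (i , i≢0 , subst (λ l → P i l ≢ 0#) j≡0 Pij≢0) (sym (𝟏≐PR 0 0)) (λ n n≢0 → trans (sym (𝟏≐PR n 0)) (𝟏-vanish n 0 (inj₁ n≢0)))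
    where
    j≡0 : j ≡ 0
    j≡0 = decidable-stable (j ℕₚ.≟ 0) (λ j≢0 → Pij≢0 (P∈F[x] i j j≢0))
    i≢0 : i ≢ 0
    i≢0 = [ id , (λ j≢0 → contradiction j≡0 j≢0) ]′ i≢0⊎j≢0

  𝟏-primitiveInY : PrimitiveInY 𝟏
  𝟏-primitiveInY (P , R , ((N , P-bounded) , P∈F[y]) , (i , j , i≢0⊎j≢0 , Pij≢0) , (M , R-bounded) , 𝟏≐PR) =
    nonconstant-not-unit (λ k → P 0 k) (λ k → R 0 k) N M (λ k N<k → P-bounded 0 k (inj₂ N<k)) (λ k M<k → R-bounded 0 k (inj₂ M<k))
      (j , j≢0 , subst (λ l → P l j ≢ 0#) i≡0 Pij≢0) (sym (𝟏≐PR 0 0)) (λ n n≢0 → trans (sym (𝟏≐PR 0 n)) (𝟏-vanish 0 n (inj₂ n≢0)))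
    where
    i≡0 : i ≡ 0
    i≡0 = decidable-stable (i ℕₚ.≟ 0) (λ i≢0 → Pij≢0 (P∈F[y] i j i≢0))
    j≢0 : j ≢ 0
    j≢0 = [ (λ i≢0 → contradiction i≡0 i≢0) , id ]′ i≢0⊎j≢0

  ·-separated : ∀ (F G : Coeffs) → (∀ i j → j ≢ 0 → F i j ≡ 0#) → (∀ i j → i ≢ 0 → G i j ≡ 0#) →
                ∀ i j → (F · G) i j ≡ F i 0 * G 0 j
  ·-separated F G F∈F[x] G∈F[y] i j = begin
    (F · G) i j                       ≡⟨ Σ≤-cong i (λ k _ → Σ≤-single j _ z≤n (off-column k)) ⟩
    Σ≤ i (λ k → F k 0 * G (i ∸ k) j)  ≡⟨ Σ≤-single i _ ℕₚ.≤-refl off-row ⟩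
    F i 0 * G (i ∸ i) j               ≡⟨ cong (λ k → F i 0 * G k j) (ℕₚ.n∸n≡0 i) ⟩
    F i 0 * G 0 j                     ∎
    where
    open ≡-Reasoning
    off-column : ∀ k l → l ≤ j → l ≢ 0 → F k l * G (i ∸ k) (j ∸ l) ≡ 0#
    off-column k l _ l≢0 = trans (cong (_* G (i ∸ k) (j ∸ l)) (F∈F[x] k l l≢0)) (zeroˡ _)
    off-row : ∀ k → k ≤ i → k ≢ i → F k 0 * G (i ∸ k) j ≡ 0#
    off-row k k≤i k≢i = trans (cong (F k 0 *_) (G∈F[y] (i ∸ k) j (∸≢0 k≤i k≢i))) (zeroʳ (F k 0))

  linearˣ linearʸ : Fin q → Fin q → Coeffs
  linearˣ a b zero          zero = a
  linearˣ a b (suc zero)    zero = b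
  linearˣ a b _             _    = 0#
  linearʸ a b zero zero          = a
  linearʸ a b zero (suc zero)    = b
  linearʸ a b _    _             = 0#

  linearˣ∈F[x] : ∀ a b → InFx (linearˣ a b)
  linearˣ∈F[x] a b = (1 , bounded) , vanish
    where
    bounded : ∀ i j → 1 < i ⊎ 1 < j → linearˣ a b i j ≡ 0#
    bounded (suc (suc i)) j            _                   = refl
    bounded zero          (suc j)      _                   = refl
    bounded (suc zero)    (suc j)      _                   = refl
    bounded zero          zero         (inj₁ ())
    bounded zero          zero         (inj₂ ())
    bounded (suc zero)    zero         (inj₁ (s≤s ()))
    bounded (suc zero)    zero         (inj₂ ())
    vanish : ∀ i j → j ≢ 0 → linearˣ a b i j ≡ 0#
    vanish i             zero    0≢0 = contradiction refl 0≢0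
    vanish zero          (suc j) _   = refl
    vanish (suc zero)    (suc j) _   = refl
    vanish (suc (suc i)) (suc j) _   = refl

  linearʸ∈F[y] : ∀ a b → InFy (linearʸ a b)
  linearʸ∈F[y] a b = (1 , bounded) , vanish
    where
    bounded : ∀ i j → 1 < i ⊎ 1 < j → linearʸ a b i j ≡ 0#
    bounded (suc i) j              _                 = refl
    bounded zero    (suc (suc j))  _                 = refl
    bounded zero    zero           (inj₁ ())
    bounded zero    zero           (inj₂ ())
    bounded zero    (suc zero)     (inj₁ ())
    bounded zero    (suc zero)     (inj₂ (s≤s ()))
    vanish : ∀ i j → i ≢ 0 → linearʸ a b i j ≡ 0#
    vanish zero    j 0≢0 = contradiction refl 0≢0
    vanish (suc i) j _   = refl

  -- If ad = bc with d ≠ 0, then a + bx + cy + dxy = (c + dx)(b/d + y).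
  degenerate-kernel : ∀ f → (∀ i j → 1 < i ⊎ 1 < j → f i j ≡ 0#) → f 1 1 ≢ 0# →
                      f 0 0 * f 1 1 ≡ f 1 0 * f 0 1 → PrimitiveKernelOf f 𝟏
  degenerate-kernel f supported d≢0 ad≡bc =
    F , G , linearˣ∈F[x] c d , linearʸ∈F[y] (b * d ⁻¹) 1# , 𝟏-isPoly , 𝟏-primitiveInX , 𝟏-primitiveInY , factorisation
    where
    open ≡-Reasoning
    a = f 0 0
    b = f 1 0
    c = f 0 1
    d = f 1 1
    F = linearˣ c d
    G = linearʸ (b * d ⁻¹) 1#
    outside : ∀ {i j} → 1 < i ⊎ 1 < j → ∀ x → f i j ≡ x * 0#
    outside i,j>1 x = trans (supported _ _ i,j>1) (sym (zeroʳ x))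
    coefficient : ∀ i j → f i j ≡ F i 0 * G 0 j
    coefficient zero zero = begin
      a                    ≡⟨ sym (*-identityʳ a) ⟩
      a * 1#               ≡⟨ cong (a *_) (sym (⁻¹-inverseʳ d≢0)) ⟩
      a * (d * d ⁻¹)       ≡⟨ sym (*-assoc a d (d ⁻¹)) ⟩
      (a * d) * d ⁻¹       ≡⟨ cong (_* d ⁻¹) ad≡bc ⟩
      (b * c) * d ⁻¹       ≡⟨ solve 3 (λ b c v → (b :* c) :* v := c :* (b :* v)) refl b c (d ⁻¹) ⟩
      c * (b * d ⁻¹)       ∎
    coefficient zero          (suc zero)    = sym (*-identityʳ c)
    coefficient zero          (suc (suc j)) = outside (inj₂ (s≤s (s≤s z≤n))) c
    coefficient (suc zero)    zero          = begin
      b                    ≡⟨ sym (*-identityʳ b) ⟩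
      b * 1#               ≡⟨ cong (b *_) (sym (⁻¹-inverseʳ d≢0)) ⟩
      b * (d * d ⁻¹)       ≡⟨ solve 3 (λ b d v → b :* (d :* v) := d :* (b :* v)) refl b d (d ⁻¹) ⟩
      d * (b * d ⁻¹)       ∎
    coefficient (suc zero)    (suc zero)    = sym (*-identityʳ d)
    coefficient (suc zero)    (suc (suc j)) = outside (inj₂ (s≤s (s≤s z≤n))) d
    coefficient (suc (suc i)) j             = trans (supported _ _ (inj₁ (s≤s (s≤s z≤n)))) (sym (zeroˡ (G 0 j)))
    factorisation : f ≐ ((F · G) · 𝟏)
    factorisation i j = trans (coefficient i j)
      (sym (trans (·-identityʳ (F · G) i j) (·-separated F G (proj₂ (linearˣ∈F[x] c d)) (proj₂ (linearʸ∈F[y] (b * d ⁻¹) 1#)) i j)))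

  admissible⇒det≢0 : ∀ f → Bidegree11 f → Admissible11 f → f 0 0 * f 1 1 - f 1 0 * f 0 1 ≢ 0#
  admissible⇒det≢0 f (supported , (j , f1j≢0) , (i , fi1≢0)) (_ , kernel-not-square) det≡0 = by-cases (f 1 1 ≟ 0#)
    where
    ad≡bc : f 0 0 * f 1 1 ≡ f 1 0 * f 0 1
    ad≡bc = x∙y⁻¹≈ε⇒x≈y _ _ det≡0
    by-cases : Dec (f 1 1 ≡ 0#) → ⊥
    by-cases (no d≢0)  = kernel-not-square 𝟏 (degenerate-kernel f supported d≢0 ad≡bc) 𝟏-constTimesSquare
    by-cases (yes d≡0) with zero-product (trans (sym ad≡bc) (trans (cong (f 0 0 *_) d≡0) (zeroʳ (f 0 0))))
    ... | inj₁ b≡0 = no-x-term j f1j≢0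
      where
      no-x-term : ∀ j → f 1 j ≢ 0# → ⊥
      no-x-term zero          f10≢0 = f10≢0 b≡0
      no-x-term (suc zero)    f11≢0 = f11≢0 d≡0
      no-x-term (suc (suc j)) f1j≢0 = f1j≢0 (supported 1 (suc (suc j)) (inj₂ (s≤s (s≤s z≤n))))
    ... | inj₂ c≡0 = no-y-term i fi1≢0
      where
      no-y-term : ∀ i → f i 1 ≢ 0# → ⊥
      no-y-term zero          f01≢0 = f01≢0 c≡0
      no-y-term (suc zero)    f11≢0 = f11≢0 d≡0
      no-y-term (suc (suc i)) fi1≢0 = fi1≢0 (supported (suc (suc i)) 1 (inj₁ (s≤s (s≤s z≤n))))

module QuadraticCharacter {q : ℕ} (𝔽 : FiniteField q) (q-odd : q % 2 ≡ 1) where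
  open FieldProperties 𝔽
  open ℤSum
  open ≡ using (refl; sym; trans; cong; cong₂; subst; module ≡-Reasoning)
  open import Relation.Nullary.Decidable using (¬?; _×-dec_; decidable-stable)

  NonzeroSquare : Fin q → Set
  NonzeroSquare x = x ≢ 0# × IsSquare x

  nonzeroSquare? : ∀ x → Dec (NonzeroSquare x)
  nonzeroSquare? x = ¬? (x ≟ 0#) ×-dec isSquare? x

  [nonzero] [square] [nonsquare] : Fin q → ℤ
  [nonzero]   x = 𝟙 (¬? (x ≟ 0#))
  [square]    x = 𝟙 (nonzeroSquare? x)
  [nonsquare] x = 𝟙 (¬? (isSquare? x))

  χ : Fin q → ℤ
  χ x = [square] x ℤ.- [nonsquare] x

  0-square : IsSquare 0#
  0-square = 0# , zeroʳ 0#

  nonsquare⇒≢0 : ∀ {x} → ¬ IsSquare x → x ≢ 0#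
  nonsquare⇒≢0 ¬sq refl = ¬sq 0-square

  data Class (x : Fin q) : Set where
    zero      : x ≡ 0# → Class x
    square    : x ≢ 0# → IsSquare x → Class x
    nonsquare : ¬ IsSquare x → Class x

  classify : ∀ x → Class x
  classify x with x ≟ 0# | isSquare? x
  ... | yes x≡0 | _        = zero x≡0
  ... | no  x≢0 | yes sq   = square x≢0 sq
  ... | no  _   | no  ¬sq  = nonsquare ¬sq

  χ-0 : χ 0# ≡ 0ℤ
  χ-0 = cong₂ ℤ._-_ (𝟙-no (nonzeroSquare? 0#) (λ p → proj₁ p refl))
                    (𝟙-no (¬? (isSquare? 0#)) (λ ¬sq → ¬sq 0-square))

  χ-square : ∀ {x} → x ≢ 0# → IsSquare x → χ x ≡ 1ℤ
  χ-square {x} x≢0 sq = cong₂ ℤ._-_ (𝟙-yes (nonzeroSquare? x) (x≢0 , sq))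
                                    (𝟙-no (¬? (isSquare? x)) (λ ¬sq → ¬sq sq))

  χ-nonsquare : ∀ {x} → ¬ IsSquare x → χ x ≡ -1ℤ
  χ-nonsquare {x} ¬sq = cong₂ ℤ._-_ (𝟙-no (nonzeroSquare? x) (λ p → ¬sq (proj₂ p)))
                                    (𝟙-yes (¬? (isSquare? x)) ¬sq)

  χ-unitBounded : ∀ x → UnitBounded (χ x)
  χ-unitBounded x with classify x
  ... | zero refl       = subst UnitBounded (sym χ-0) ℕ.z≤n
  ... | square x≢0 sq   = subst UnitBounded (sym (χ-square x≢0 sq)) ℕₚ.≤-refl
  ... | nonsquare ¬sq   = subst UnitBounded (sym (χ-nonsquare ¬sq)) ℕₚ.≤-refl

  [nonzero]≡[square]+[nonsquare] : ∀ x → [nonzero] x ≡ [square] x ℤ.+ [nonsquare] x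
  [nonzero]≡[square]+[nonsquare] x with x ≟ 0# | isSquare? x
  ... | yes _   | yes _   = refl
  ... | yes x≡0 | no  ¬sq = contradiction (subst IsSquare (sym x≡0) 0-square) ¬sq
  ... | no  _   | yes _   = refl
  ... | no  _   | no  _   = refl

  1+1≢0 : 1# + 1# ≢ 0#
  1+1≢0 = odd⇒1+1≢0 q-odd

  ≢0⇒≢- : ∀ {w} → w ≢ 0# → w ≢ - w
  ≢0⇒≢- {w} w≢0 w≡-w = w≢0 (*-cancelˡ w 0# 1+1≢0 (begin
    (1# + 1#) * w    ≡⟨ distribʳ w 1# 1# ⟩
    1# * w + 1# * w  ≡⟨ cong₂ _+_ (*-identityˡ w) (*-identityˡ w) ⟩
    w + w            ≡⟨ cong (_+ w) w≡-w ⟩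
    - w + w          ≡⟨ -‿inverseˡ w ⟩
    0#               ≡⟨ sym (zeroʳ (1# + 1#)) ⟩
    (1# + 1#) * 0#   ∎))
    where open ≡-Reasoning

  square-injective-± : ∀ {z w} → z * z ≡ w * w → z ≡ w ⊎ z ≡ - w
  square-injective-± {z} {w} z²≡w² with zero-product difference-of-squares
    where
    difference-of-squares : (z - w) * (z + w) ≡ 0#
    difference-of-squares = begin
      (z - w) * (z + w)    ≡⟨ solve 2 (λ z w → (z :- w) :* (z :+ w) := z :* z :- w :* w) refl z w ⟩
      z * z - w * w        ≡⟨ cong (_- w * w) z²≡w² ⟩
      w * w - w * w        ≡⟨ -‿inverseʳ (w * w) ⟩
      0#                   ∎
      where open ≡-Reasoning
  ... | inj₁ z-w≡0 = inj₁ (x∙y⁻¹≈ε⇒x≈y z w z-w≡0)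
  ... | inj₂ z+w≡0 = inj₂ (+-cancelʳ w z (- w) (trans z+w≡0 (sym (-‿inverseˡ w))))

  δ-square : ∀ {w} → w ≢ 0# → ∀ z → δ (w * w) (z * z) ≡ δ z w ℤ.+ δ z (- w)
  δ-square {w} w≢0 z with z ≟ w | z ≟ (- w)
  ... | yes refl | yes z≡-z = contradiction z≡-z (≢0⇒≢- w≢0)
  ... | yes refl | no  _    = δ-refl (z * z)
  ... | no  _    | yes refl = trans (cong (λ y → δ y (- w * - w)) (solve 1 (λ w → w :* w := (:- w) :* (:- w)) refl w)) (δ-refl (- w * - w))
  ... | no  z≢w  | no  z≢-w = δ-≢ w²≢z²
    where
    w²≢z² : w * w ≢ z * z
    w²≢z² w²≡z² with square-injective-± (sym w²≡z²)
    ... | inj₁ z≡w  = z≢w z≡w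
    ... | inj₂ z≡-w = z≢-w z≡-w

  count-square-roots : ∀ {y} → NonzeroSquare y → ∑ (λ z → δ y (z * z)) ≡ ℤ.+ 2
  count-square-roots (w²≢0 , w , refl) = begin
    ∑ (λ z → δ (w * w) (z * z))               ≡⟨ sum-cong-≗ (δ-square w≢0) ⟩
    ∑ (λ z → δ z w ℤ.+ δ z (- w))             ≡⟨ ∑-distrib-+ (λ z → δ z w) (λ z → δ z (- w)) ⟩
    ∑ (λ z → δ z w) ℤ.+ ∑ (λ z → δ z (- w))   ≡⟨ cong₂ ℤ._+_ (sum-δ w) (sum-δ (- w)) ⟩
    ℤ.+ 2                                      ∎
    where
    open ≡-Reasoning
    w≢0 : w ≢ 0#
    w≢0 w≡0 = w²≢0 (trans (cong (_* w) w≡0) (zeroˡ w))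

  count-square-roots-weighted : ∀ y → ∑ (λ z → δ y (z * z)) ℤ.* [square] y ≡ ℤ.+ 2 ℤ.* [square] y
  count-square-roots-weighted y with nonzeroSquare? y
  ... | yes p = cong (ℤ._* [square] y) (count-square-roots p)
  ... | no ¬p = begin
    roots ℤ.* [square] y   ≡⟨ cong (roots ℤ.*_) [square]y≡0 ⟩
    roots ℤ.* 0ℤ           ≡⟨ ℤₚ.*-zeroʳ roots ⟩
    0ℤ                     ≡⟨ ℤₚ.*-zeroʳ (ℤ.+ 2) ⟨
    ℤ.+ 2 ℤ.* 0ℤ           ≡⟨ cong (ℤ.+ 2 ℤ.*_) [square]y≡0 ⟨
    ℤ.+ 2 ℤ.* [square] y   ∎
    where
    open ≡-Reasoning
    roots = ∑ (λ z → δ y (z * z))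
    [square]y≡0 : [square] y ≡ 0ℤ
    [square]y≡0 = 𝟙-no (nonzeroSquare? y) ¬p

  [square]-of-square : ∀ z → [square] (z * z) ≡ [nonzero] z
  [square]-of-square z with z ≟ 0#
  ... | yes refl = 𝟙-no (nonzeroSquare? (0# * 0#)) (λ p → proj₁ p (zeroˡ 0#))
  ... | no  z≢0  = 𝟙-yes (nonzeroSquare? (z * z)) (*-≢0 z≢0 z≢0 , z , refl)

  ∑[nonzero]≡2∑[square] : ∑ [nonzero] ≡ ℤ.+ 2 ℤ.* ∑ [square]
  ∑[nonzero]≡2∑[square] = begin
    ∑ [nonzero]                                    ≡⟨ sum-cong-≗ (λ z → trans (sym ([square]-of-square z)) (sym (sum-δ-* (z * z) [square]))) ⟩
    ∑ (λ z → ∑ (λ y → δ y (z * z) ℤ.* [square] y)) ≡⟨ ∑-comm (λ z y → δ y (z * z) ℤ.* [square] y) ⟩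
    ∑ (λ y → ∑ (λ z → δ y (z * z) ℤ.* [square] y)) ≡⟨ sum-cong-≗ (λ y → sum-*ʳ ([square] y) (λ z → δ y (z * z))) ⟩
    ∑ (λ y → ∑ (λ z → δ y (z * z)) ℤ.* [square] y) ≡⟨ sum-cong-≗ count-square-roots-weighted ⟩
    ∑ (λ y → ℤ.+ 2 ℤ.* [square] y)                 ≡⟨ sum-*ˡ (ℤ.+ 2) [square] ⟩
    ℤ.+ 2 ℤ.* ∑ [square]                           ∎
    where open ≡-Reasoning

  ∑[nonsquare]≡∑[square] : ∑ [nonsquare] ≡ ∑ [square]
  ∑[nonsquare]≡∑[square] = ∙-cancelˡ (∑ [square]) (∑ [nonsquare]) (∑ [square]) (begin
    ∑ [square] ℤ.+ ∑ [nonsquare]             ≡⟨ sym (∑-distrib-+ [square] [nonsquare]) ⟩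
    ∑ (λ x → [square] x ℤ.+ [nonsquare] x)   ≡⟨ sym (sum-cong-≗ [nonzero]≡[square]+[nonsquare]) ⟩
    ∑ [nonzero]                              ≡⟨ ∑[nonzero]≡2∑[square] ⟩
    ℤ.+ 2 ℤ.* ∑ [square]                     ≡⟨ ℤₚ.*-distribʳ-+ (∑ [square]) 1ℤ 1ℤ ⟩
    1ℤ ℤ.* ∑ [square] ℤ.+ 1ℤ ℤ.* ∑ [square]  ≡⟨ cong₂ ℤ._+_ (ℤₚ.*-identityˡ (∑ [square])) (ℤₚ.*-identityˡ (∑ [square])) ⟩
    ∑ [square] ℤ.+ ∑ [square]                ∎)
    where
    open ≡-Reasoning
    open import Algebra.Properties.AbelianGroup ℤₚ.+-0-abelianGroup using (∙-cancelˡ)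

  ∑χ≡0 : ∑ χ ≡ 0ℤ
  ∑χ≡0 = trans (∑-distrib-- [square] [nonsquare]) (trans (cong (ℤ._-_ (∑ [square])) ∑[nonsquare]≡∑[square]) (ℤₚ.+-inverseʳ (∑ [square])))

  *-square : ∀ {x y} → IsSquare x → IsSquare y → IsSquare (x * y)
  *-square (a , refl) (b , refl) = a * b , solve 2 (λ a b → (a :* b) :* (a :* b) := (a :* a) :* (b :* b)) refl a b

  square-cancelˡ : ∀ {a b} → a ≢ 0# → IsSquare a → IsSquare (a * b) → IsSquare b
  square-cancelˡ {a} {b} a≢0 (w , refl) (z , z²≡ab) = z * w ⁻¹ , (begin
    (z * w ⁻¹) * (z * w ⁻¹)       ≡⟨ solve 2 (λ z u → (z :* u) :* (z :* u) := (z :* z) :* (u :* u)) refl z (w ⁻¹) ⟩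
    (z * z) * (w ⁻¹ * w ⁻¹)       ≡⟨ cong (_* (w ⁻¹ * w ⁻¹)) z²≡ab ⟩
    ((w * w) * b) * (w ⁻¹ * w ⁻¹) ≡⟨ solve 3 (λ w b u → ((w :* w) :* b) :* (u :* u) := b :* ((w :* u) :* (w :* u))) refl w b (w ⁻¹) ⟩
    b * ((w * w ⁻¹) * (w * w ⁻¹)) ≡⟨ cong (λ k → b * (k * k)) (⁻¹-inverseʳ w≢0) ⟩
    b * (1# * 1#)                 ≡⟨ cong (b *_) (*-identityˡ 1#) ⟩
    b * 1#                        ≡⟨ *-identityʳ b ⟩
    b                             ∎)
    where
    open ≡-Reasoning
    w≢0 : w ≢ 0#
    w≢0 w≡0 = a≢0 (trans (cong (_* w) w≡0) (zeroˡ w))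

  -- Multiplication by a nonsquare n maps nonzero squares to nonsquares; as there are equally
  -- many of both, the excess  [nonsquare] (n * x) − [square] x  is nonnegative with zero sum,
  -- hence vanishes, also at the nonsquare m.
  nonsquare*nonsquare : ∀ {n m} → ¬ IsSquare n → ¬ IsSquare m → IsSquare (n * m)
  nonsquare*nonsquare {n} {m} ¬sq-n ¬sq-m = decidable-stable (isSquare? (n * m)) λ ¬sq-nm →
    contradiction (trans (sym (excess-m≡1 ¬sq-nm)) (excess≡0 m)) λ ()
    where
    n≢0 = nonsquare⇒≢0 ¬sq-n
    excess : Fin q → ℤ
    excess x = [nonsquare] (n * x) ℤ.- [square] x
    0≤excess : ∀ x → 0ℤ ℤ.≤ excess x
    0≤excess x with nonzeroSquare? x
    ... | no  ¬p           = subst (0ℤ ℤ.≤_) (sym (trans (cong (ℤ._-_ ([nonsquare] (n * x))) (𝟙-no (nonzeroSquare? x) ¬p))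
                                                         (ℤₚ.+-identityʳ ([nonsquare] (n * x)))))
                                              (bit-nonNeg _)
    ... | yes (x≢0 , sq-x) = ℤₚ.≤-reflexive (sym (cong₂ ℤ._-_ (𝟙-yes (¬? (isSquare? (n * x))) ¬sq-nx) (𝟙-yes (nonzeroSquare? x) (x≢0 , sq-x))))
      where
      ¬sq-nx : ¬ IsSquare (n * x)
      ¬sq-nx sq-nx = ¬sq-n (square-cancelˡ x≢0 sq-x (subst IsSquare (*-comm n x) sq-nx))
    ∑excess≡0 : ∑ excess ≡ 0ℤ
    ∑excess≡0 = begin
      ∑ excess                                      ≡⟨ ∑-distrib-- ([nonsquare] ∘ (n *_)) [square] ⟩
      ∑ ([nonsquare] ∘ (n *_)) ℤ.- ∑ [square]       ≡⟨ cong (ℤ._- ∑ [square]) (sum-reindex (n *_) (n ⁻¹ *_) cancel cancel′ [nonsquare]) ⟩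
      ∑ [nonsquare] ℤ.- ∑ [square]                  ≡⟨ cong (ℤ._- ∑ [square]) ∑[nonsquare]≡∑[square] ⟩
      ∑ [square] ℤ.- ∑ [square]                     ≡⟨ ℤₚ.+-inverseʳ (∑ [square]) ⟩
      0ℤ                                            ∎
      where
      open ≡-Reasoning
      cancel : ∀ x → n * (n ⁻¹ * x) ≡ x
      cancel x = trans (sym (*-assoc n (n ⁻¹) x)) (trans (cong (_* x) (⁻¹-inverseʳ n≢0)) (*-identityˡ x))
      cancel′ : ∀ x → n ⁻¹ * (n * x) ≡ x
      cancel′ x = trans (sym (*-assoc (n ⁻¹) n x)) (trans (cong (_* x) (⁻¹-inverseˡ n≢0)) (*-identityˡ x))
    excess≡0 = sum-nonNeg≡0⇒≡0 0≤excess ∑excess≡0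
    excess-m≡1 : ¬ IsSquare (n * m) → excess m ≡ 1ℤ
    excess-m≡1 ¬sq-nm = cong₂ ℤ._-_ (𝟙-yes (¬? (isSquare? (n * m))) ¬sq-nm) (𝟙-no (nonzeroSquare? m) (¬sq-m ∘ proj₂))

  χ-homo-* : ∀ x y → χ (x * y) ≡ χ x ℤ.* χ y
  χ-homo-* x y with classify x | classify y
  ... | zero refl | _ = trans (cong χ (zeroˡ y)) (trans χ-0 (sym (cong (ℤ._* χ y) χ-0)))
  ... | square _ _ | zero refl = trans (cong χ (zeroʳ x)) (trans χ-0 (sym (trans (cong (χ x ℤ.*_) χ-0) (ℤₚ.*-zeroʳ (χ x)))))
  ... | nonsquare _ | zero refl = trans (cong χ (zeroʳ x)) (trans χ-0 (sym (trans (cong (χ x ℤ.*_) χ-0) (ℤₚ.*-zeroʳ (χ x)))))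
  ... | square x≢0 sq-x | square y≢0 sq-y =
    trans (χ-square (*-≢0 x≢0 y≢0) (*-square sq-x sq-y)) (sym (cong₂ ℤ._*_ (χ-square x≢0 sq-x) (χ-square y≢0 sq-y)))
  ... | square x≢0 sq-x | nonsquare ¬sq-y =
    trans (χ-nonsquare (λ sq-xy → ¬sq-y (square-cancelˡ x≢0 sq-x sq-xy))) (sym (cong₂ ℤ._*_ (χ-square x≢0 sq-x) (χ-nonsquare ¬sq-y)))
  ... | nonsquare ¬sq-x | square y≢0 sq-y =
    trans (χ-nonsquare (λ sq-xy → ¬sq-x (square-cancelˡ y≢0 sq-y (subst IsSquare (*-comm x y) sq-xy))))
          (sym (cong₂ ℤ._*_ (χ-nonsquare ¬sq-x) (χ-square y≢0 sq-y)))
  ... | nonsquare ¬sq-x | nonsquare ¬sq-y =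
    trans (χ-square (*-≢0 (nonsquare⇒≢0 ¬sq-x) (nonsquare⇒≢0 ¬sq-y)) (nonsquare*nonsquare ¬sq-x ¬sq-y))
          (sym (cong₂ ℤ._*_ (χ-nonsquare ¬sq-x) (χ-nonsquare ¬sq-y)))

  χ²≡1 : ∀ {x} → x ≢ 0# → χ x ℤ.* χ x ≡ 1ℤ
  χ²≡1 {x} x≢0 = trans (sym (χ-homo-* x x)) (χ-square (*-≢0 x≢0 x≢0) (x , refl))

  module AffineMap {β} (α : Fin q) (β≢0 : β ≢ 0#) where
    to from : Fin q → Fin q
    to   s = α + β * s
    from u = β ⁻¹ * (u - α)

    to∘from : ∀ u → to (from u) ≡ u
    to∘from u = begin
      α + β * (β ⁻¹ * (u - α))   ≡⟨ cong (α +_) (sym (*-assoc β (β ⁻¹) (u - α))) ⟩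
      α + (β * β ⁻¹) * (u - α)   ≡⟨ cong (λ k → α + k * (u - α)) (⁻¹-inverseʳ β≢0) ⟩
      α + 1# * (u - α)           ≡⟨ cong (α +_) (*-identityˡ (u - α)) ⟩
      α + (u - α)                ≡⟨ solve 2 (λ α u → α :+ (u :- α) := u) refl α u ⟩
      u                          ∎
      where open ≡-Reasoning

    from∘to : ∀ s → from (to s) ≡ s
    from∘to s = begin
      β ⁻¹ * ((α + β * s) - α)   ≡⟨ cong (β ⁻¹ *_) (solve 3 (λ α β s → (α :+ β :* s) :- α := β :* s) refl α β s) ⟩
      β ⁻¹ * (β * s)             ≡⟨ sym (*-assoc (β ⁻¹) β s) ⟩
      (β ⁻¹ * β) * s             ≡⟨ cong (_* s) (⁻¹-inverseˡ β≢0) ⟩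
      1# * s                     ≡⟨ *-identityˡ s ⟩
      s                          ∎
      where open ≡-Reasoning

  ∑χ-affine : ∀ α {β} → β ≢ 0# → ∑ (λ s → χ (α + β * s)) ≡ 0ℤ
  ∑χ-affine α β≢0 = trans (sum-reindex to from to∘from from∘to χ) ∑χ≡0
    where open AffineMap α β≢0

  χ-inversion : ∀ γ d u → Dec (u ≡ 0#) → χ u ℤ.* χ (γ * u + d) ≡ χ (γ + d * u ⁻¹) ℤ.- δ u 0# ℤ.* χ γ
  χ-inversion γ d u (yes refl) = begin
    χ 0# ℤ.* χ (γ * 0# + d)               ≡⟨ cong (ℤ._* χ (γ * 0# + d)) χ-0 ⟩
    0ℤ                                    ≡⟨ sym (ℤₚ.+-inverseʳ (χ γ)) ⟩
    χ γ ℤ.- χ γ                           ≡⟨ cong₂ ℤ._-_ (cong χ (sym γ+d0⁻¹≡γ)) (sym (ℤₚ.*-identityˡ (χ γ))) ⟩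
    χ (γ + d * 0# ⁻¹) ℤ.- 1ℤ ℤ.* χ γ      ≡⟨ cong (λ k → χ (γ + d * 0# ⁻¹) ℤ.- k ℤ.* χ γ) (sym (δ-refl 0#)) ⟩
    χ (γ + d * 0# ⁻¹) ℤ.- δ 0# 0# ℤ.* χ γ ∎
    where
    open ≡-Reasoning
    γ+d0⁻¹≡γ : γ + d * 0# ⁻¹ ≡ γ
    γ+d0⁻¹≡γ = trans (cong (λ k → γ + d * k) 0⁻¹≡0) (trans (cong (γ +_) (zeroʳ d)) (+-identityʳ γ))
  χ-inversion γ d u (no u≢0) = begin
    χ u ℤ.* χ (γ * u + d)                   ≡⟨ cong (λ k → χ u ℤ.* χ k) factor ⟩
    χ u ℤ.* χ (u * (γ + d * u ⁻¹))          ≡⟨ cong (χ u ℤ.*_) (χ-homo-* u (γ + d * u ⁻¹)) ⟩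
    χ u ℤ.* (χ u ℤ.* χ (γ + d * u ⁻¹))      ≡⟨ sym (ℤₚ.*-assoc (χ u) (χ u) _) ⟩
    (χ u ℤ.* χ u) ℤ.* χ (γ + d * u ⁻¹)      ≡⟨ cong (ℤ._* χ (γ + d * u ⁻¹)) (χ²≡1 u≢0) ⟩
    1ℤ ℤ.* χ (γ + d * u ⁻¹)                 ≡⟨ ℤₚ.*-identityˡ _ ⟩
    χ (γ + d * u ⁻¹)                        ≡⟨ sym (ℤₚ.+-identityʳ _) ⟩
    χ (γ + d * u ⁻¹) ℤ.- 0ℤ ℤ.* χ γ         ≡⟨ cong (λ k → χ (γ + d * u ⁻¹) ℤ.- k ℤ.* χ γ) (sym (δ-≢ u≢0)) ⟩
    χ (γ + d * u ⁻¹) ℤ.- δ u 0# ℤ.* χ γ     ∎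
    where
    open ≡-Reasoning
    factor : γ * u + d ≡ u * (γ + d * u ⁻¹)
    factor = sym (begin
      u * (γ + d * u ⁻¹)        ≡⟨ solve 4 (λ u γ d v → u :* (γ :+ d :* v) := γ :* u :+ d :* (u :* v)) refl u γ d (u ⁻¹) ⟩
      γ * u + d * (u * u ⁻¹)    ≡⟨ cong (λ k → γ * u + d * k) (⁻¹-inverseʳ u≢0) ⟩
      γ * u + d * 1#            ≡⟨ cong (γ * u +_) (*-identityʳ d) ⟩
      γ * u + d                 ∎)

  -- After χ-inversion and the substitution u ↦ u⁻¹, only an affine character sum and the term u = 0 remain.
  jacobsthal : ∀ γ {d} → d ≢ 0# → ∑ (λ u → χ u ℤ.* χ (γ * u + d)) ≡ ℤ.- χ γ
  jacobsthal γ {d} d≢0 = begin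
    ∑ (λ u → χ u ℤ.* χ (γ * u + d))
      ≡⟨ sum-cong-≗ (λ u → χ-inversion γ d u (u ≟ 0#)) ⟩
    ∑ (λ u → χ (γ + d * u ⁻¹) ℤ.- δ u 0# ℤ.* χ γ)
      ≡⟨ ∑-distrib-- (λ u → χ (γ + d * u ⁻¹)) (λ u → δ u 0# ℤ.* χ γ) ⟩
    ∑ (λ u → χ (γ + d * u ⁻¹)) ℤ.- ∑ (λ u → δ u 0# ℤ.* χ γ)
      ≡⟨ cong₂ ℤ._-_ (sum-reindex _⁻¹ _⁻¹ ⁻¹-involutive ⁻¹-involutive (λ w → χ (γ + d * w))) (sum-δ-* 0# (λ _ → χ γ)) ⟩
    ∑ (λ w → χ (γ + d * w)) ℤ.- χ γ
      ≡⟨ cong (ℤ._- χ γ) (∑χ-affine γ d≢0) ⟩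
    0ℤ ℤ.- χ γ
      ≡⟨ ℤₚ.+-identityˡ (ℤ.- χ γ) ⟩
    ℤ.- χ γ ∎
    where open ≡-Reasoning
  ∑χχ-affine : ∀ α {β} α′ β′ → β ≢ 0# → α * β′ - α′ * β ≢ 0# →
               ∑ (λ s → χ (α + β * s) ℤ.* χ (α′ + β′ * s)) ≡ ℤ.- χ (β′ * β ⁻¹)
  ∑χχ-affine α {β} α′ β′ β≢0 det≢0 = begin
    ∑ (λ s → χ (α + β * s) ℤ.* χ (α′ + β′ * s))        ≡⟨ sum-reindex from to from∘to to∘from _ ⟨
    ∑ (λ u → χ (to (from u)) ℤ.* χ (α′ + β′ * from u)) ≡⟨ sum-cong-≗ (λ u → cong₂ ℤ._*_ (cong χ (to∘from u)) (cong χ (second u))) ⟩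
    ∑ (λ u → χ u ℤ.* χ (γ * u + d))                    ≡⟨ jacobsthal γ d≢0 ⟩
    ℤ.- χ γ                                            ∎
    where
    open ≡-Reasoning
    open AffineMap α β≢0
    γ = β′ * β ⁻¹
    d = α′ - γ * α
    second : ∀ u → α′ + β′ * from u ≡ γ * u + d
    second u = solve 5 (λ α α′ β′ b u → α′ :+ β′ :* (b :* (u :- α)) := (β′ :* b) :* u :+ (α′ :- (β′ :* b) :* α))
                       refl α α′ β′ (β ⁻¹) u
    dβ≡-det : d * β ≡ - (α * β′ - α′ * β)
    dβ≡-det = begin
      (α′ - γ * α) * β
        ≡⟨ solve 5 (λ α α′ β β′ b → (α′ :- (β′ :* b) :* α) :* β := α′ :* β :- β′ :* α :* (b :* β)) refl α α′ β β′ (β ⁻¹) ⟩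
      α′ * β - β′ * α * (β ⁻¹ * β)
        ≡⟨ cong (λ k → α′ * β - β′ * α * k) (⁻¹-inverseˡ β≢0) ⟩
      α′ * β - β′ * α * 1#
        ≡⟨ cong (λ k → α′ * β - k) (*-identityʳ (β′ * α)) ⟩
      α′ * β - β′ * α
        ≡⟨ solve 4 (λ α α′ β β′ → α′ :* β :- β′ :* α := :- (α :* β′ :- α′ :* β)) refl α α′ β β′ ⟩
      - (α * β′ - α′ * β) ∎
    d≢0 : d ≢ 0#
    d≢0 d≡0 = det≢0 (begin
      α * β′ - α′ * β           ≡⟨ sym (-‿involutive _) ⟩
      - - (α * β′ - α′ * β)     ≡⟨ cong -_ (sym dβ≡-det) ⟩
      - (d * β)                 ≡⟨ cong (λ k → - (k * β)) d≡0 ⟩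
      - (0# * β)                ≡⟨ cong -_ (zeroˡ β) ⟩
      - 0#                      ≡⟨ -0#≈0# ⟩
      0#                        ∎)

  ∑χχ-affine-unitBounded : ∀ α β α′ β′ → α * β′ - α′ * β ≢ 0# →
                           UnitBounded (∑ (λ s → χ (α + β * s) ℤ.* χ (α′ + β′ * s)))
  ∑χχ-affine-unitBounded α β α′ β′ det≢0 = by-cases (β ≟ 0#) (β′ ≟ 0#)
    where
    open ≡-Reasoning
    S = ∑ (λ s → χ (α + β * s) ℤ.* χ (α′ + β′ * s))
    χ-constant : ∀ a s → χ (a + 0# * s) ≡ χ a
    χ-constant a s = cong χ (trans (cong (a +_) (zeroˡ s)) (+-identityʳ a))
    by-cases : Dec (β ≡ 0#) → Dec (β′ ≡ 0#) → UnitBounded S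
    by-cases (yes refl) (yes refl) = contradiction (trans (cong₂ _-_ (zeroʳ α) (zeroʳ α′)) (-‿inverseʳ 0#)) det≢0
    by-cases (yes refl) (no β′≢0)  = subst UnitBounded (sym (begin
      S                                  ≡⟨ sum-cong-≗ (λ s → cong (ℤ._* χ (α′ + β′ * s)) (χ-constant α s)) ⟩
      ∑ (λ s → χ α ℤ.* χ (α′ + β′ * s))  ≡⟨ sum-*ˡ (χ α) (λ s → χ (α′ + β′ * s)) ⟩
      χ α ℤ.* ∑ (λ s → χ (α′ + β′ * s))  ≡⟨ cong (χ α ℤ.*_) (∑χ-affine α′ β′≢0) ⟩
      χ α ℤ.* 0ℤ                         ≡⟨ ℤₚ.*-zeroʳ (χ α) ⟩
      0ℤ                                 ∎)) ℕ.z≤n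
    by-cases (no β≢0)   (yes refl) = subst UnitBounded (sym (begin
      S                                  ≡⟨ sum-cong-≗ (λ s → cong (χ (α + β * s) ℤ.*_) (χ-constant α′ s)) ⟩
      ∑ (λ s → χ (α + β * s) ℤ.* χ α′)   ≡⟨ sum-*ʳ (χ α′) (λ s → χ (α + β * s)) ⟩
      ∑ (λ s → χ (α + β * s)) ℤ.* χ α′   ≡⟨ cong (ℤ._* χ α′) (∑χ-affine α β≢0) ⟩
      0ℤ ℤ.* χ α′                        ≡⟨ ℤₚ.*-zeroˡ (χ α′) ⟩
      0ℤ                                 ∎)) ℕ.z≤n
    by-cases (no β≢0)   (no _)     = subst UnitBounded (sym (∑χχ-affine α α′ β′ β≢0 det≢0))
                                           (unitBounded-neg {χ (β′ * β ⁻¹)} (χ-unitBounded (β′ * β ⁻¹)))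

module EdgeCount {q : ℕ} (𝔽 : FiniteField q) where
  open FieldProperties 𝔽 using (∑; edges; adjᵇ; 0#)
  open ℤSum
  open ≡ using (refl; sym; trans; cong; cong₂; subst; module ≡-Reasoning)
  open import Data.Integer using (+_; _+_; _*_; _-_; _≤_)
  open import Data.Bool using (_∧_; if_then_else_)
  open import Data.Vec using (lookup)
  open import Data.Fin.Subset using (Subset; ∣_∣)
  open import Data.List using (map; allFin)
  open import Data.Nat.ListAction using () renaming (sum to listSum)
  open import Data.Integer.Tactic.RingSolver using (solve-∀)

  ±1 : Bool → ℤ
  ±1 true  = 1ℤ
  ±1 false = -1ℤ

  ±1-unitBounded : ∀ b → UnitBounded (±1 b)
  ±1-unitBounded true  = ℕₚ.≤-refl
  ±1-unitBounded false = ℕₚ.≤-refl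

  sign : (Fin q → Fin q → Fin q) → Fin q → Fin q → ℤ
  sign p s t = ±1 (adjᵇ p s t)

  weight : Subset q → Fin q → ℤ
  weight S s = bit (lookup S s)

  weight-nonNeg : ∀ S s → 0ℤ ≤ weight S s
  weight-nonNeg S s = bit-nonNeg (lookup S s)

  weight≤1 : ∀ S s → weight S s ≤ 1ℤ
  weight≤1 S s = bit≤1 (lookup S s)

  weight-*≤ : ∀ S s {x} → 0ℤ ≤ x → weight S s * x ≤ x
  weight-*≤ S s {x} 0≤x = subst (weight S s * x ≤_) (ℤₚ.*-identityˡ x) (ℤₚ.*-monoʳ-≤-nonNeg x {{ℤ.nonNegative 0≤x}} (weight≤1 S s))

  edges-as-∑ : ∀ p S T → + edges p S T ≡ ∑ (λ s → ∑ (λ t → weight S s * (weight T t * bit (adjᵇ p s t))))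
  edges-as-∑ p S T =
    trans (listSum-allFin (λ s → listSum (map (λ t → indicator s t) (allFin q))))
          (sum-cong-≗ (λ s → trans (listSum-allFin (indicator s))
                                   (sum-cong-≗ (λ t → bit-∧ (lookup S s) (lookup T t) (adjᵇ p s t)))))
    where
    indicator : Fin q → Fin q → ℕ
    indicator s t = if lookup S s ∧ lookup T t ∧ adjᵇ p s t then 1 else 0
    bit-∧ : ∀ a b c → + (if a ∧ b ∧ c then 1 else 0) ≡ bit a * (bit b * bit c)
    bit-∧ true  true  true  = refl
    bit-∧ true  true  false = refl
    bit-∧ true  false _     = refl
    bit-∧ false _     _     = refl

  signedDegree : (Fin q → Fin q → Fin q) → Subset q → Fin q → ℤ
  signedDegree p T s = ∑ (λ t → weight T t * sign p s t)

  discrepancy≡∑signedDegree : ∀ p S T →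
    + (2 ℕ.* edges p S T) - + (∣ S ∣ ℕ.* ∣ T ∣) ≡ ∑ (λ s → weight S s * signedDegree p T s)
  discrepancy≡∑signedDegree p S T = begin
    + (2 ℕ.* edges p S T) - + (∣ S ∣ ℕ.* ∣ T ∣)
      ≡⟨ cong₂ _-_ (trans (ℤₚ.pos-* 2 (edges p S T)) (cong (_*_ (+ 2)) (edges-as-∑ p S T)))
                   (trans (ℤₚ.pos-* ∣ S ∣ ∣ T ∣) (trans (cong₂ _*_ ∣ S ∣-as-sum ∣ T ∣-as-sum) (sum-*-sum (weight S) (weight T)))) ⟩
    + 2 * ∑ (λ s → ∑ (A s)) - ∑ (λ s → ∑ (B s))
      ≡⟨ cong (_- ∑ (λ s → ∑ (B s))) (sym (trans (sum-cong-≗ (λ s → sum-*ˡ (+ 2) (A s))) (sum-*ˡ (+ 2) (λ s → ∑ (A s))))) ⟩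
    ∑ (λ s → ∑ (λ t → + 2 * A s t)) - ∑ (λ s → ∑ (B s))
      ≡⟨ sym (trans (sum-cong-≗ (λ s → ∑-distrib-- (λ t → + 2 * A s t) (B s)))
                    (∑-distrib-- (λ s → ∑ (λ t → + 2 * A s t)) (λ s → ∑ (B s)))) ⟩
    ∑ (λ s → ∑ (λ t → + 2 * A s t - B s t))
      ≡⟨ sum-cong-≗ (λ s → trans (sum-cong-≗ (λ t → to-sign s t)) (sum-*ˡ (weight S s) (λ t → weight T t * sign p s t))) ⟩
    ∑ (λ s → weight S s * signedDegree p T s) ∎
    where
    open ≡-Reasoning
    A B : Fin q → Fin q → ℤ
    A s t = weight S s * (weight T t * bit (adjᵇ p s t))
    B s t = weight S s * weight T t
    ±1≡2bit-1 : ∀ b → + 2 * bit b - 1ℤ ≡ ±1 b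
    ±1≡2bit-1 true  = refl
    ±1≡2bit-1 false = refl
    factor : ∀ x y e → + 2 * (x * (y * e)) - x * y ≡ x * (y * (+ 2 * e - 1ℤ))
    factor = solve-∀
    to-sign : ∀ s t → + 2 * A s t - B s t ≡ weight S s * (weight T t * sign p s t)
    to-sign s t = trans (factor (weight S s) (weight T t) (bit (adjᵇ p s t)))
                        (cong (λ k → weight S s * (weight T t * k)) (±1≡2bit-1 (adjᵇ p s t)))

  codegree : (Fin q → Fin q → Fin q) → Fin q → Fin q → ℤ
  codegree p t t′ = ∑ (λ s → sign p s t * sign p s t′)

  ∑signedDegree² : ∀ p T → ∑ (λ s → signedDegree p T s * signedDegree p T s)
                          ≡ ∑ (λ t → ∑ (λ t′ → weight T t * weight T t′ * codegree p t t′))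
  ∑signedDegree² p T = begin
    ∑ (λ s → signedDegree p T s * signedDegree p T s)
      ≡⟨ sum-cong-≗ (λ s → sum-*-sum (λ t → w t * sign p s t) (λ t′ → w t′ * sign p s t′)) ⟩
    ∑ (λ s → ∑ (λ t → ∑ (λ t′ → G s t t′)))
      ≡⟨ ∑-comm (λ s t → ∑ (G s t)) ⟩
    ∑ (λ t → ∑ (λ s → ∑ (λ t′ → G s t t′)))
      ≡⟨ sum-cong-≗ (λ t → ∑-comm (λ s t′ → G s t t′)) ⟩
    ∑ (λ t → ∑ (λ t′ → ∑ (λ s → G s t t′)))
      ≡⟨ sum-cong-≗ (λ t → sum-cong-≗ (λ t′ → trans (sum-cong-≗ (regroup t t′)) (sum-*ˡ (w t * w t′) (λ s → sign p s t * sign p s t′)))) ⟩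
    ∑ (λ t → ∑ (λ t′ → w t * w t′ * codegree p t t′)) ∎
    where
    open ≡-Reasoning
    w = weight T
    G : Fin q → Fin q → Fin q → ℤ
    G s t t′ = w t * sign p s t * (w t′ * sign p s t′)
    interchange : ∀ a x b y → a * x * (b * y) ≡ a * b * (x * y)
    interchange = solve-∀
    regroup : ∀ t t′ s → G s t t′ ≡ w t * w t′ * (sign p s t * sign p s t′)
    regroup t t′ s = interchange (w t) (sign p s t) (w t′) (sign p s t′)

  sign*sign≤1 : ∀ p s t t′ → sign p s t * sign p s t′ ≤ 1ℤ
  sign*sign≤1 p s t t′ = unitBounded⇒≤1 (unitBounded-* {sign p s t} (±1-unitBounded (adjᵇ p s t)) (±1-unitBounded (adjᵇ p s t′)))

  codegree≤q : ∀ p t t′ → codegree p t t′ ≤ + q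
  codegree≤q p t t′ = subst (codegree p t t′ ≤_) (ℤₚ.*-identityʳ (+ q)) (sum-≤-const 1ℤ (λ s → sign*sign≤1 p s t t′))

  -- Pairs through the vertex 0 are excused: in X_{xyf,q} the vertex 0 is adjacent to every other vertex.
  CodegreeBound : (Fin q → Fin q → Fin q) → ℕ → Set
  CodegreeBound p K = ∀ t t′ → t ≢ t′ → t ≢ 0# → t′ ≢ 0# → codegree p t t′ ≤ + K

  exceptional : Fin q → Fin q → ℤ
  exceptional t t′ = δ t t′ + (δ t 0# + δ t′ 0#)

  codegree≤ : ∀ p K → CodegreeBound p K → ∀ t t′ → codegree p t t′ ≤ + q * exceptional t t′ + + K
  codegree≤ p K bound t t′ = by-cases (t Fin.≟ t′) (t Fin.≟ 0#) (t′ Fin.≟ 0#)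
    where
    open ℤₚ.≤-Reasoning
    hit : 1ℤ ≤ exceptional t t′ → codegree p t t′ ≤ + q * exceptional t t′ + + K
    hit 1≤e = begin
      codegree p t t′             ≤⟨ codegree≤q p t t′ ⟩
      + q                         ≡⟨ ℤₚ.*-identityʳ (+ q) ⟨
      + q * 1ℤ                    ≤⟨ ℤₚ.*-monoˡ-≤-nonNeg (+ q) 1≤e ⟩
      + q * exceptional t t′      ≤⟨ ℤₚ.i≤i+j (+ q * exceptional t t′) (+ K) ⟩
      + q * exceptional t t′ + + K ∎
    δ≡1 : ∀ {i j : Fin q} → i ≡ j → 1ℤ ≤ δ i j
    δ≡1 {i} refl = ℤₚ.≤-reflexive (sym (δ-refl i))
    by-cases : Dec (t ≡ t′) → Dec (t ≡ 0#) → Dec (t′ ≡ 0#) → codegree p t t′ ≤ + q * exceptional t t′ + + K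
    by-cases (yes t≡t′) _ _ =
      hit (ℤₚ.≤-trans (δ≡1 t≡t′) (ℤₚ.i≤i+j _ _ {{ℤ.nonNegative (ℤₚ.+-mono-≤ (δ-nonNeg t 0#) (δ-nonNeg t′ 0#))}}))
    by-cases (no _) (yes t≡0) _ = hit (ℤₚ.≤-trans (ℤₚ.≤-trans (δ≡1 t≡0) (ℤₚ.i≤i+j _ _ {{ℤ.nonNegative (δ-nonNeg t′ 0#)}}))
                                                (ℤₚ.i≤j+i _ _ {{ℤ.nonNegative (δ-nonNeg t t′)}}))
    by-cases (no _) (no _) (yes t′≡0) = hit (ℤₚ.≤-trans (ℤₚ.≤-trans (δ≡1 t′≡0) (ℤₚ.i≤j+i _ _ {{ℤ.nonNegative (δ-nonNeg t 0#)}}))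
                                                      (ℤₚ.i≤j+i _ _ {{ℤ.nonNegative (δ-nonNeg t t′)}}))
    by-cases (no t≢t′) (no t≢0) (no t′≢0) = begin
      codegree p t t′               ≤⟨ bound t t′ t≢t′ t≢0 t′≢0 ⟩
      + K                           ≡⟨ ℤₚ.+-identityˡ (+ K) ⟨
      0ℤ + + K                      ≡⟨ cong (_+ + K) (sym (trans (cong (+ q *_) e≡0) (ℤₚ.*-zeroʳ (+ q)))) ⟩
      + q * exceptional t t′ + + K  ∎
      where
      e≡0 : exceptional t t′ ≡ 0ℤ
      e≡0 = cong₂ _+_ (δ-≢ t≢t′) (cong₂ _+_ (δ-≢ t≢0) (δ-≢ t′≢0))

  ∑weight²exceptional≤ : ∀ T → ∑ (λ t → ∑ (λ t′ → weight T t * weight T t′ * exceptional t t′)) ≤ + 3 * ∑ (weight T)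
  ∑weight²exceptional≤ T = begin
    ∑ (λ t → ∑ (λ t′ → w t * w t′ * exceptional t t′))
      ≤⟨ sum-mono-≤ (λ t → sum-mono-≤ (λ t′ → drop-weights t t′)) ⟩
    ∑ (λ t → ∑ (λ t′ → δ t′ t * w t′ + (δ t 0# * w t′ + w t * δ t′ 0#)))
      ≡⟨ sum-cong-≗ (λ t → sum-three t) ⟩
    ∑ (λ t → w t + (δ t 0# * W + w t))
      ≡⟨ trans (∑-distrib-+ w _) (cong (_+_ W) (trans (∑-distrib-+ (λ t → δ t 0# * W) w) (cong (_+ W) (sum-δ-* 0# (λ _ → W))))) ⟩
    W + (W + W)
      ≡⟨ triple W ⟩
    + 3 * W ∎
    where
    open ℤₚ.≤-Reasoning
    w = weight T
    W = ∑ w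
    triple : ∀ x → x + (x + x) ≡ + 3 * x
    triple = solve-∀
    expand : ∀ a b d₁ d₂ d₃ → a * b * (d₁ + (d₂ + d₃)) ≡ a * (b * d₁) + (a * (d₂ * b) + b * (a * d₃))
    expand = solve-∀
    drop-weights : ∀ t t′ → w t * w t′ * exceptional t t′ ≤ δ t′ t * w t′ + (δ t 0# * w t′ + w t * δ t′ 0#)
    drop-weights t t′ = subst (_≤ δ t′ t * w t′ + (δ t 0# * w t′ + w t * δ t′ 0#)) (sym (expand (w t) (w t′) (δ t t′) (δ t 0#) (δ t′ 0#)))
      (ℤₚ.+-mono-≤ (subst (w t * (w t′ * δ t t′) ≤_) (trans (ℤₚ.*-comm (w t′) (δ t t′)) (cong (_* w t′) (δ-sym t t′)))
                          (weight-*≤ T t (*-nonNeg (weight-nonNeg T t′) (δ-nonNeg t t′))))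
                   (ℤₚ.+-mono-≤ (weight-*≤ T t (*-nonNeg (δ-nonNeg t 0#) (weight-nonNeg T t′)))
                                (weight-*≤ T t′ (*-nonNeg (weight-nonNeg T t) (δ-nonNeg t′ 0#)))))
    sum-three : ∀ t → ∑ (λ t′ → δ t′ t * w t′ + (δ t 0# * w t′ + w t * δ t′ 0#)) ≡ w t + (δ t 0# * W + w t)
    sum-three t =
      trans (∑-distrib-+ (λ t′ → δ t′ t * w t′) _)
            (cong₂ _+_ (sum-δ-* t w)
                       (trans (∑-distrib-+ (λ t′ → δ t 0# * w t′) (λ t′ → w t * δ t′ 0#))
                              (cong₂ _+_ (sum-*ˡ (δ t 0#) w)
                                         (trans (sum-*ˡ (w t) (λ t′ → δ t′ 0#)) (trans (cong (_*_ (w t)) (sum-δ 0#)) (ℤₚ.*-identityʳ (w t)))))))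

  ∑weight²codegree≤ : ∀ p K → CodegreeBound p K → ∀ T →
    ∑ (λ t → ∑ (λ t′ → weight T t * weight T t′ * codegree p t t′)) ≤ + (3 ℕ.+ K) * + q * ∑ (weight T)
  ∑weight²codegree≤ p K bound T = begin
    ∑ (λ t → ∑ (λ t′ → ww t t′ * codegree p t t′))
      ≤⟨ sum-mono-≤ (λ t → sum-mono-≤ (λ t′ →
           ℤₚ.*-monoˡ-≤-nonNeg (ww t t′) {{ℤ.nonNegative (0≤ww t t′)}} (codegree≤ p K bound t t′))) ⟩
    ∑ (λ t → ∑ (λ t′ → ww t t′ * (+ q * exceptional t t′ + + K)))
      ≡⟨ sum-cong-≗ (λ t → trans (sum-cong-≗ (λ t′ → distribute (ww t t′) (+ q) (exceptional t t′) (+ K)))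
                                  (trans (∑-distrib-+ (λ t′ → + q * (ww t t′ * exceptional t t′)) (λ t′ → + K * ww t t′))
                                         (cong₂ _+_ (sum-*ˡ (+ q) (λ t′ → ww t t′ * exceptional t t′)) (sum-*ˡ (+ K) (ww t))))) ⟩
    ∑ (λ t → + q * ∑ (λ t′ → ww t t′ * exceptional t t′) + + K * ∑ (ww t))
      ≡⟨ trans (∑-distrib-+ (λ t → + q * ∑ (λ t′ → ww t t′ * exceptional t t′)) (λ t → + K * ∑ (ww t)))
               (cong₂ _+_ (sum-*ˡ (+ q) (λ t → ∑ (λ t′ → ww t t′ * exceptional t t′)))
                          (trans (sum-*ˡ (+ K) (λ t → ∑ (ww t))) (cong (+ K *_) (sym (sum-*-sum w w))))) ⟩
    + q * ∑ (λ t → ∑ (λ t′ → ww t t′ * exceptional t t′)) + + K * (W * W)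
      ≤⟨ ℤₚ.+-mono-≤ (ℤₚ.*-monoˡ-≤-nonNeg (+ q) (∑weight²exceptional≤ T))
                     (ℤₚ.*-monoˡ-≤-nonNeg (+ K) (ℤₚ.*-monoʳ-≤-nonNeg W {{ℤ.nonNegative 0≤W}} W≤q)) ⟩
    + q * (+ 3 * W) + + K * (+ q * W)
      ≡⟨ collect W (+ q) (+ K) ⟩
    + (3 ℕ.+ K) * + q * W ∎
    where
    open ℤₚ.≤-Reasoning
    w = weight T
    W = ∑ w
    ww : Fin q → Fin q → ℤ
    ww t t′ = w t * w t′
    0≤ww : ∀ t t′ → 0ℤ ≤ ww t t′
    0≤ww t t′ = *-nonNeg (weight-nonNeg T t) (weight-nonNeg T t′)
    0≤W : 0ℤ ≤ W
    0≤W = sum-nonNeg (weight-nonNeg T)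
    W≤q : W ≤ + q
    W≤q = subst (W ≤_) (ℤₚ.*-identityʳ (+ q)) (sum-≤-const 1ℤ (weight≤1 T))
    distribute : ∀ a b e k → a * (b * e + k) ≡ b * (a * e) + k * a
    distribute = solve-∀
    collect : ∀ x b k → b * (+ 3 * x) + k * (b * x) ≡ (+ 3 + k) * b * x
    collect = solve-∀

  qr-bound : ∀ p K → CodegreeBound p K → QRBound q (3 ℕ.+ K) edges p
  qr-bound p K bound S T = begin
    d * d
      ≡⟨ cong₂ _*_ (discrepancy≡∑signedDegree p S T) (discrepancy≡∑signedDegree p S T) ⟩
    ∑ (λ s → wS s * X s) * ∑ (λ s → wS s * X s)
      ≤⟨ cauchy-schwarz wS X (weight-nonNeg S) ⟩
    WS * ∑ (λ s → wS s * (X s * X s))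
      ≤⟨ ℤₚ.*-monoˡ-≤-nonNeg WS {{ℤ.nonNegative (sum-nonNeg (weight-nonNeg S))}} (sum-mono-≤ λ s → weight-*≤ S s (square-nonNeg (X s))) ⟩
    WS * ∑ (λ s → X s * X s)
      ≡⟨ cong (WS *_) (∑signedDegree² p T) ⟩
    WS * ∑ (λ t → ∑ (λ t′ → weight T t * weight T t′ * codegree p t t′))
      ≤⟨ ℤₚ.*-monoˡ-≤-nonNeg WS {{ℤ.nonNegative (sum-nonNeg (weight-nonNeg S))}} (∑weight²codegree≤ p K bound T) ⟩
    WS * (+ (3 ℕ.+ K) * + q * ∑ (weight T))
      ≡⟨ cong₂ (λ x y → x * (+ (3 ℕ.+ K) * + q * y)) (sym ∣ S ∣-as-sum) (sym ∣ T ∣-as-sum) ⟩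
    + ∣ S ∣ * (+ (3 ℕ.+ K) * + q * + ∣ T ∣)
      ≡⟨ rearrange (+ ∣ S ∣) (+ (3 ℕ.+ K) * + q) (+ ∣ T ∣) ⟩
    + (3 ℕ.+ K) * + q * + ∣ S ∣ * + ∣ T ∣
      ≡⟨ cong (λ x → x * + ∣ S ∣ * + ∣ T ∣) (sym (ℤₚ.pos-* (3 ℕ.+ K) q)) ⟩
    + ((3 ℕ.+ K) ℕ.* q) * + ∣ S ∣ * + ∣ T ∣
      ≡⟨ cong (_* + ∣ T ∣) (sym (ℤₚ.pos-* ((3 ℕ.+ K) ℕ.* q) ∣ S ∣)) ⟩
    + ((3 ℕ.+ K) ℕ.* q ℕ.* ∣ S ∣) * + ∣ T ∣
      ≡⟨ sym (ℤₚ.pos-* ((3 ℕ.+ K) ℕ.* q ℕ.* ∣ S ∣) ∣ T ∣) ⟩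
    + ((3 ℕ.+ K) ℕ.* q ℕ.* ∣ S ∣ ℕ.* ∣ T ∣) ∎
    where
    open ℤₚ.≤-Reasoning
    d = + (2 ℕ.* edges p S T) - + (∣ S ∣ ℕ.* ∣ T ∣)
    wS = weight S
    WS = ∑ wS
    X = signedDegree p T
    rearrange : ∀ a b c → a * (b * c) ≡ b * a * c
    rearrange = solve-∀

module CharacterCodegree {q : ℕ} (𝔽 : FiniteField q) (q-odd : q % 2 ≡ 1) where
  open FieldProperties 𝔽
  open QuadraticCharacter 𝔽 q-odd
  open EdgeCount 𝔽 using (±1; sign; codegree; sign*sign≤1)
  open import Relation.Nullary.Decidable using (dec-true; dec-false)
  open ℤSum using (UnitBounded; unitBounded⇒-1≤; sum-≤-off)
  open ≡ using (sym; trans; cong)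
  open import Data.List using (List; length)
  open import Data.List.Membership.Propositional using (_∉_)

  sign≡χ : ∀ p {s t} → s ≢ t → p s t ≢ 0# → sign p s t ≡ χ (p s t)
  sign≡χ p {s} {t} s≢t pst≢0 with s ≟ t
  ... | yes s≡t = contradiction s≡t s≢t
  ... | no  _ with classify (p s t)
  ...   | zero pst≡0    = contradiction pst≡0 pst≢0
  ...   | square _ sq   = trans (cong ±1 (dec-true (isSquare? (p s t)) sq)) (sym (χ-square pst≢0 sq))
  ...   | nonsquare ¬sq = trans (cong ±1 (dec-false (isSquare? (p s t)) ¬sq)) (sym (χ-nonsquare ¬sq))

  codegree≤-via-character : ∀ p t t′ (E : List (Fin q)) {h : Fin q → ℤ} → (∀ s → UnitBounded (h s)) →
    (∀ s → s ∉ E → sign p s t ℤ.* sign p s t′ ≡ h s) → ∑ h ℤ.≤ 1ℤ → codegree p t t′ ℤ.≤ ℤ.+ (1 ℕ.+ 2 ℕ.* length E)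
  codegree≤-via-character p t t′ E {h} h-bounded agree ∑h≤1 = begin
    codegree p t t′                   ≤⟨ sum-≤-off E (λ s → sign*sign≤1 p s t t′) (λ s → unitBounded⇒-1≤ (h-bounded s)) agree ⟩
    ∑ h ℤ.+ ℤ.+ 2 ℤ.* ℤ.+ length E   ≤⟨ ℤₚ.+-monoˡ-≤ (ℤ.+ 2 ℤ.* ℤ.+ length E) ∑h≤1 ⟩
    1ℤ ℤ.+ ℤ.+ 2 ℤ.* ℤ.+ length E    ≡⟨ cong (ℤ._+_ 1ℤ) (sym (ℤₚ.pos-* 2 (length E))) ⟩
    ℤ.+ (1 ℕ.+ 2 ℕ.* length E)        ∎
    where open ℤₚ.≤-Reasoning

module BidegreeOneOne {q : ℕ} (𝔽 : FiniteField q) (q-odd : q % 2 ≡ 1) (f : FiniteField.Coeffs 𝔽) where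
  open FieldProperties 𝔽

  det : Fin q
  det = f 0 0 * f 1 1 - f 1 0 * f 0 1

  module Nondegenerate (det≢0 : det ≢ 0#) where
    open QuadraticCharacter 𝔽 q-odd
    open EdgeCount 𝔽 using (sign; CodegreeBound)
    open CharacterCodegree 𝔽 q-odd
    open ℤSum using (UnitBounded; unitBounded-*; unitBounded⇒≤1; sum-*ˡ)
    open ≡ using (refl; sym; trans; cong; cong₂; subst; module ≡-Reasoning)
    open import Data.List using ([]; _∷_)
    open import Data.List.Relation.Unary.Any using (here; there)
    open import Data.List.Membership.Propositional using (_∉_)
    open import Data.Integer.Tactic.RingSolver using (solve-∀)

    α β : Fin q → Fin q
    α t = f 0 0 + f 0 1 * t
    β t = f 1 0 + f 1 1 * t

    line : Fin q → Fin q → Fin q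
    line t s = α t + β t * s

    eval11≡line : ∀ s t → eval11 f s t ≡ line t s
    eval11≡line s t = solve 6 (λ a b c d s t → a :+ b :* s :+ c :* t :+ d :* (s :* t) := (a :+ c :* t) :+ (b :+ d :* t) :* s)
                              refl (f 0 0) (f 1 0) (f 0 1) (f 1 1) s t

    lines-independent : ∀ {t t′} → t ≢ t′ → α t * β t′ - α t′ * β t ≢ 0#
    lines-independent {t} {t′} t≢t′ det′≡0 = *-≢0 det≢0 t′-t≢0 (trans (sym factor) det′≡0)
      where
      factor : α t * β t′ - α t′ * β t ≡ det * (t′ - t)
      factor = solve 6 (λ a b c d t u → (a :+ c :* t) :* (b :+ d :* u) :- (a :+ c :* u) :* (b :+ d :* t)
                                        := (a :* d :- b :* c) :* (u :- t))
                       refl (f 0 0) (f 1 0) (f 0 1) (f 1 1) t t′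
      t′-t≢0 : t′ - t ≢ 0#
      t′-t≢0 t′-t≡0 = t≢t′ (sym (x∙y⁻¹≈ε⇒x≈y t′ t t′-t≡0))

    β≡0⇒α≢0 : ∀ t → β t ≡ 0# → α t ≢ 0#
    β≡0⇒α≢0 t βt≡0 αt≡0 = lines-independent t≢t+1 (begin
      α t * β (t + 1#) - α (t + 1#) * β t   ≡⟨ cong₂ (λ x y → x * β (t + 1#) - α (t + 1#) * y) αt≡0 βt≡0 ⟩
      0# * β (t + 1#) - α (t + 1#) * 0#     ≡⟨ cong₂ _-_ (zeroˡ _) (zeroʳ _) ⟩
      0# - 0#                               ≡⟨ -‿inverseʳ 0# ⟩
      0#                                    ∎)
      where
      open ≡-Reasoning
      t≢t+1 : t ≢ t + 1#
      t≢t+1 t≡t+1 = 1≢0 (+-cancelʳ t 1# 0# (trans (+-comm 1# t) (trans (sym t≡t+1) (sym (+-identityˡ t)))))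

    -- When β t = 0 the line has no root and root t is the junk value 0; excluding it is harmless.
    root : Fin q → Fin q
    root t = - α t * β t ⁻¹

    line≢0 : ∀ {s t} → s ≢ root t → line t s ≢ 0#
    line≢0 {s} {t} s≢root = by-cases (β t ≟ 0#)
      where
      open ≡-Reasoning
      by-cases : Dec (β t ≡ 0#) → line t s ≢ 0#
      by-cases (yes βt≡0) line≡0 = β≡0⇒α≢0 t βt≡0 (begin
        α t              ≡⟨ sym (+-identityʳ (α t)) ⟩
        α t + 0#         ≡⟨ cong (α t +_) (sym (zeroˡ s)) ⟩
        α t + 0# * s     ≡⟨ cong (λ k → α t + k * s) (sym βt≡0) ⟩
        line t s         ≡⟨ line≡0 ⟩
        0#               ∎)
      by-cases (no βt≢0) line≡0 = s≢root (begin
        s                      ≡⟨ sym (*-identityˡ s) ⟩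
        1# * s                 ≡⟨ cong (_* s) (sym (⁻¹-inverseˡ βt≢0)) ⟩
        (β t ⁻¹ * β t) * s     ≡⟨ *-assoc (β t ⁻¹) (β t) s ⟩
        β t ⁻¹ * (β t * s)     ≡⟨ cong (β t ⁻¹ *_) βs≡-α ⟩
        β t ⁻¹ * - α t         ≡⟨ *-comm (β t ⁻¹) (- α t) ⟩
        - α t * β t ⁻¹         ∎)
        where
        βs≡-α : β t * s ≡ - α t
        βs≡-α = +-cancelʳ (α t) (β t * s) (- α t) (trans (+-comm (β t * s) (α t)) (trans line≡0 (sym (-‿inverseˡ (α t)))))

    χ-line-pair : Fin q → Fin q → Fin q → ℤ
    χ-line-pair t t′ s = χ (line t s) ℤ.* χ (line t′ s)

    χ-line-pair-unitBounded : ∀ t t′ s → UnitBounded (χ-line-pair t t′ s)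
    χ-line-pair-unitBounded t t′ s = unitBounded-* {χ (line t s)} (χ-unitBounded (line t s)) (χ-unitBounded (line t′ s))

    ∑χ-line-pair-unitBounded : ∀ {t t′} → t ≢ t′ → UnitBounded (∑ (χ-line-pair t t′))
    ∑χ-line-pair-unitBounded {t} {t′} t≢t′ = ∑χχ-affine-unitBounded (α t) (β t) (α t′) (β t′) (lines-independent t≢t′)

    eval11≢0 : ∀ {s t} → s ≢ root t → eval11 f s t ≢ 0#
    eval11≢0 {s} {t} s≢root f≡0 = line≢0 s≢root (trans (sym (eval11≡line s t)) f≡0)

    sign-graphF : ∀ {s t} → s ≢ t → s ≢ root t → sign (graphF f) s t ≡ χ (line t s)
    sign-graphF {s} {t} s≢t s≢root = trans (sign≡χ (graphF f) s≢t (eval11≢0 s≢root)) (cong χ (eval11≡line s t))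

    sign-graphXYF : ∀ {s t} → s ≢ t → s ≢ 0# → t ≢ 0# → s ≢ root t → sign (graphXYF f) s t ≡ χ s ℤ.* χ t ℤ.* χ (line t s)
    sign-graphXYF {s} {t} s≢t s≢0 t≢0 s≢root = begin
      sign (graphXYF f) s t          ≡⟨ sign≡χ (graphXYF f) s≢t (*-≢0 (*-≢0 s≢0 t≢0) (eval11≢0 s≢root)) ⟩
      χ (s * t * eval11 f s t)       ≡⟨ χ-homo-* (s * t) (eval11 f s t) ⟩
      χ (s * t) ℤ.* χ (eval11 f s t) ≡⟨ cong₂ ℤ._*_ (χ-homo-* s t) (cong χ (eval11≡line s t)) ⟩
      χ s ℤ.* χ t ℤ.* χ (line t s)   ∎
      where open ≡-Reasoning

    codegree-graphF : CodegreeBound (graphF f) 9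
    codegree-graphF t t′ t≢t′ _ _ =
      codegree≤-via-character (graphF f) t t′ E (χ-line-pair-unitBounded t t′) agree (unitBounded⇒≤1 (∑χ-line-pair-unitBounded t≢t′))
      where
      E = t ∷ t′ ∷ root t ∷ root t′ ∷ []
      agree : ∀ s → s ∉ E → sign (graphF f) s t ℤ.* sign (graphF f) s t′ ≡ χ-line-pair t t′ s
      agree s s∉E = cong₂ ℤ._*_ (sign-graphF (s∉E ∘ here) (s∉E ∘ there ∘ there ∘ here))
                                (sign-graphF (s∉E ∘ there ∘ here) (s∉E ∘ there ∘ there ∘ there ∘ here))

    codegree-graphXYF : CodegreeBound (graphXYF f) 11
    codegree-graphXYF t t′ t≢t′ t≢0 t′≢0 =
      codegree≤-via-character (graphXYF f) t t′ E {h} h-unitBounded agree ∑h≤1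
      where
      E = t ∷ t′ ∷ root t ∷ root t′ ∷ 0# ∷ []
      c = χ t ℤ.* χ t′
      c-unitBounded : UnitBounded c
      c-unitBounded = unitBounded-* {χ t} (χ-unitBounded t) (χ-unitBounded t′)
      h : Fin q → ℤ
      h s = c ℤ.* χ-line-pair t t′ s
      h-unitBounded : ∀ s → UnitBounded (h s)
      h-unitBounded s = unitBounded-* {c} c-unitBounded (χ-line-pair-unitBounded t t′ s)
      ∑h≤1 : ∑ h ℤ.≤ 1ℤ
      ∑h≤1 = unitBounded⇒≤1 (subst UnitBounded (sym (sum-*ˡ c (χ-line-pair t t′)))
                                                (unitBounded-* {c} c-unitBounded (∑χ-line-pair-unitBounded t≢t′)))
      regroup : ∀ x y y′ l l′ → (x ℤ.* y ℤ.* l) ℤ.* (x ℤ.* y′ ℤ.* l′) ≡ (x ℤ.* x) ℤ.* ((y ℤ.* y′) ℤ.* (l ℤ.* l′))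
      regroup = solve-∀
      agree : ∀ s → s ∉ E → sign (graphXYF f) s t ℤ.* sign (graphXYF f) s t′ ≡ h s
      agree s s∉E = begin
        sign (graphXYF f) s t ℤ.* sign (graphXYF f) s t′
          ≡⟨ cong₂ ℤ._*_ (sign-graphXYF (s∉E ∘ here) s≢0 t≢0 (s∉E ∘ there ∘ there ∘ here))
                         (sign-graphXYF (s∉E ∘ there ∘ here) s≢0 t′≢0 (s∉E ∘ there ∘ there ∘ there ∘ here)) ⟩
        (χ s ℤ.* χ t ℤ.* χ (line t s)) ℤ.* (χ s ℤ.* χ t′ ℤ.* χ (line t′ s))
          ≡⟨ regroup (χ s) (χ t) (χ t′) (χ (line t s)) (χ (line t′ s)) ⟩
        (χ s ℤ.* χ s) ℤ.* h s
          ≡⟨ cong (ℤ._* h s) (χ²≡1 s≢0) ⟩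
        1ℤ ℤ.* h s
          ≡⟨ ℤₚ.*-identityˡ (h s) ⟩
        h s ∎
        where
        open ≡-Reasoning
        s≢0 : s ≢ 0#
        s≢0 = s∉E ∘ there ∘ there ∘ there ∘ there ∘ here

QRBound-mono : ∀ {q C C′ e p} → C ℕ.≤ C′ → QRBound q C e p → QRBound q C′ e p
QRBound-mono {q} C≤C′ bound S T = ℤₚ.≤-trans (bound S T)
  (ℤ.+≤+ (ℕₚ.*-monoˡ-≤ ∣ T ∣ (ℕₚ.*-monoˡ-≤ ∣ S ∣ (ℕₚ.*-monoˡ-≤ q C≤C′))))
  where open import Data.Fin.Subset using (∣_∣)

corollary5p6 : ∃[ C ] (∀ (q : ℕ) → q % 2 ≡ 1 → (𝔽 : FiniteField q) →
    let open FiniteField 𝔽 in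
    ∀ (f : Coeffs) → Bidegree11 f → Admissible11 f →
    QRBound q C edges (graphF f) × QRBound q C edges (graphXYF f))
corollary5p6 = 14 , λ q q-odd 𝔽 f bidegree admissible →
  let open BidegreeOneOne.Nondegenerate 𝔽 q-odd f (Admissibility.admissible⇒det≢0 𝔽 f bidegree admissible)
      open EdgeCount 𝔽 using (qr-bound)
      open FiniteField 𝔽 using (edges; graphF; graphXYF)
  in QRBound-mono {e = edges} {graphF f} (ℕₚ.+-monoʳ-≤ 3 (ℕₚ.m≤n+m 9 2)) (qr-bound (graphF f) 9 codegree-graphF) ,
     qr-bound (graphXYF f) 11 codegree-graphXYF
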